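{- A finite simple graph $H$ is a hereditary biclique line graph if and only if $H$ contains no induced claw, no induced diamond, and no induced $C_4$.
   Context: A biclique of a graph $G$ is a vertex set $B\subseteq V(G)$ such that $G[B]$ is a complete bipartite graph and $B$ is inclusion-wise maximal with this property. The biclique line graph $L_G$ has vertex set $E(G)$, two edges of $G$ being adjacent iff they are both edges of $G[B]$ for some biclique $B$ of $G$. A graph is a biclique line graph if it is isomorphic to $L_G$ for some graph $G$, and a hereditary biclique line graph if every induced subgraph of it is a biclique line graph. The claw is $K_{1,3}$, the diamond is $K_4$ minus one edge, and $C_4$ is the cycle on four vertices. -}

module Defs where

open import Data.Nat using (ℕ)
open import Data.Fin using (Fin; zero; suc; _<_)
open import Data.Bool using (Bool; true; false)
open import Data.Product using (Σ; ∃; ∃-syntax; _×_; _,_)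
open import Data.Sum using (_⊎_)
open import Relation.Nullary using (¬_)
open import Relation.Binary.PropositionalEquality using (_≡_)
open import Function.Bundles using (_⤖_; Bijection)
open import Function.Definitions using (Injective)

record Graph : Set where
  field
    n      : ℕ
    adj    : Fin n → Fin n → Bool
    sym    : ∀ u v → adj u v ≡ adj v u
    irrefl : ∀ u → adj u u ≡ false
open Graph public

VSet : Graph → Set
VSet G = Fin (n G) → Bool

_∈ˢ_ : ∀ {m} → Fin m → (Fin m → Bool) → Set
u ∈ˢ B = B u ≡ true

_⊆ˢ_ : ∀ {m} → (Fin m → Bool) → (Fin m → Bool) → Set
_⊆ˢ_ {m} A B = ∀ (u : Fin m) → u ∈ˢ A → u ∈ˢ B

IsCompleteBipartite : (G : Graph) → VSet G → Set
IsCompleteBipartite G B =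
  Σ (VSet G) λ X → Σ (VSet G) λ Y →
    (∀ u → u ∈ˢ B → (u ∈ˢ X × ¬ (u ∈ˢ Y)) ⊎ (u ∈ˢ Y × ¬ (u ∈ˢ X)))
  × (∀ u → u ∈ˢ X → u ∈ˢ B)
  × (∀ u → u ∈ˢ Y → u ∈ˢ B)
  × (∃[ x ] x ∈ˢ X)
  × (∃[ y ] y ∈ˢ Y)
  × (∀ u v → u ∈ˢ B → v ∈ˢ B →
       (adj G u v ≡ true → (u ∈ˢ X × v ∈ˢ Y) ⊎ (u ∈ˢ Y × v ∈ˢ X))
     × ((u ∈ˢ X × v ∈ˢ Y) ⊎ (u ∈ˢ Y × v ∈ˢ X) → adj G u v ≡ true))

IsBiclique : (G : Graph) → VSet G → Set
IsBiclique G B =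
  IsCompleteBipartite G B
  × (∀ (B′ : VSet G) → IsCompleteBipartite G B′ → B ⊆ˢ B′ → B′ ⊆ˢ B)

-- Edges of G, each represented once as an ordered pair u < v.
Edge : Graph → Set
Edge G = Σ (Fin (n G) × Fin (n G)) λ { (u , v) → (u < v) × (adj G u v ≡ true) }

EdgeIn : (G : Graph) → Edge G → VSet G → Set
EdgeIn G ((u , v) , _) B = u ∈ˢ B × v ∈ˢ B

LAdj : (G : Graph) → Edge G → Edge G → Set
LAdj G e f = ¬ (e ≡ f) × (∃[ B ] (IsBiclique G B × EdgeIn G e B × EdgeIn G f B))

IsBicliqueLineGraph : Graph → Set
IsBicliqueLineGraph H =
  Σ Graph λ G → Σ (Fin (n H) ⤖ Edge G) λ φ →
    ∀ u v → (adj H u v ≡ true → LAdj G (Bijection.to φ u) (Bijection.to φ v))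
          × (LAdj G (Bijection.to φ u) (Bijection.to φ v) → adj H u v ≡ true)

-- The induced subgraph of H on the image of an injective map Fin m → V(H)
-- (every induced subgraph arises this way up to relabelling).
induced : (H : Graph) (m : ℕ) (f : Fin m → Fin (n H)) → Graph
induced H m f = record
  { n = m
  ; adj = λ i j → adj H (f i) (f j)
  ; sym = λ i j → sym H (f i) (f j)
  ; irrefl = λ i → irrefl H (f i)
  }

IsHereditaryBicliqueLineGraph : Graph → Set
IsHereditaryBicliqueLineGraph H =
  ∀ (m : ℕ) (f : Fin m → Fin (n H)) → Injective _≡_ _≡_ f →
    IsBicliqueLineGraph (induced H m f)

ContainsInduced : (H F : Graph) → Set
ContainsInduced H F =
  Σ (Fin (n F) → Fin (n H)) λ f → Injective _≡_ _≡_ f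
    × (∀ i j → adj H (f i) (f j) ≡ adj F i j)

private
  F4 = Fin 4
  pattern v0 = zero
  pattern v1 = suc zero
  pattern v2 = suc (suc zero)
  pattern v3 = suc (suc (suc zero))

clawAdj : Fin 4 → Fin 4 → Bool
clawAdj v0 v1 = true
clawAdj v0 v2 = true
clawAdj v0 v3 = true
clawAdj v1 v0 = true
clawAdj v2 v0 = true
clawAdj v3 v0 = true
clawAdj _  _  = false

diamondAdj : Fin 4 → Fin 4 → Bool
diamondAdj v0 v0 = false
diamondAdj v1 v1 = false
diamondAdj v2 v2 = false
diamondAdj v3 v3 = false
diamondAdj v2 v3 = false
diamondAdj v3 v2 = false
diamondAdj _  _  = true

c4Adj : Fin 4 → Fin 4 → Bool
c4Adj v0 v1 = true
c4Adj v1 v0 = true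
c4Adj v1 v2 = true
c4Adj v2 v1 = true
c4Adj v2 v3 = true
c4Adj v3 v2 = true
c4Adj v3 v0 = true
c4Adj v0 v3 = true
c4Adj _  _  = false

clawSym : ∀ u v → clawAdj u v ≡ clawAdj v u
clawSym v0 v0 = _≡_.refl
clawSym v0 v1 = _≡_.refl
clawSym v0 v2 = _≡_.refl
clawSym v0 v3 = _≡_.refl
clawSym v1 v0 = _≡_.refl
clawSym v1 v1 = _≡_.refl
clawSym v1 v2 = _≡_.refl
clawSym v1 v3 = _≡_.refl
clawSym v2 v0 = _≡_.refl
clawSym v2 v1 = _≡_.refl
clawSym v2 v2 = _≡_.refl
clawSym v2 v3 = _≡_.refl
clawSym v3 v0 = _≡_.refl
clawSym v3 v1 = _≡_.refl
clawSym v3 v2 = _≡_.refl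
clawSym v3 v3 = _≡_.refl

diamondSym : ∀ u v → diamondAdj u v ≡ diamondAdj v u
diamondSym v0 v0 = _≡_.refl
diamondSym v0 v1 = _≡_.refl
diamondSym v0 v2 = _≡_.refl
diamondSym v0 v3 = _≡_.refl
diamondSym v1 v0 = _≡_.refl
diamondSym v1 v1 = _≡_.refl
diamondSym v1 v2 = _≡_.refl
diamondSym v1 v3 = _≡_.refl
diamondSym v2 v0 = _≡_.refl
diamondSym v2 v1 = _≡_.refl
diamondSym v2 v2 = _≡_.refl
diamondSym v2 v3 = _≡_.refl
diamondSym v3 v0 = _≡_.refl
diamondSym v3 v1 = _≡_.refl
diamondSym v3 v2 = _≡_.refl
diamondSym v3 v3 = _≡_.refl

c4Sym : ∀ u v → c4Adj u v ≡ c4Adj v u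
c4Sym v0 v0 = _≡_.refl
c4Sym v0 v1 = _≡_.refl
c4Sym v0 v2 = _≡_.refl
c4Sym v0 v3 = _≡_.refl
c4Sym v1 v0 = _≡_.refl
c4Sym v1 v1 = _≡_.refl
c4Sym v1 v2 = _≡_.refl
c4Sym v1 v3 = _≡_.refl
c4Sym v2 v0 = _≡_.refl
c4Sym v2 v1 = _≡_.refl
c4Sym v2 v2 = _≡_.refl
c4Sym v2 v3 = _≡_.refl
c4Sym v3 v0 = _≡_.refl
c4Sym v3 v1 = _≡_.refl
c4Sym v3 v2 = _≡_.refl
c4Sym v3 v3 = _≡_.refl

claw : Graph
claw = record { n = 4 ; adj = clawAdj ; sym = clawSym
              ; irrefl = λ { v0 → _≡_.refl ; v1 → _≡_.refl ; v2 → _≡_.refl ; v3 → _≡_.refl } }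

diamond : Graph
diamond = record { n = 4 ; adj = diamondAdj ; sym = diamondSym
                 ; irrefl = λ { v0 → _≡_.refl ; v1 → _≡_.refl ; v2 → _≡_.refl ; v3 → _≡_.refl } }

C4 : Graph
C4 = record { n = 4 ; adj = c4Adj ; sym = c4Sym
            ; irrefl = λ { v0 → _≡_.refl ; v1 → _≡_.refl ; v2 → _≡_.refl ; v3 → _≡_.refl } }

-- If H is a hereditary biclique line graph, each of claw, diamond and C4 is some L_G. Two edges
-- of G adjacent in L_G either share an endpoint, their other ends being non-adjacent, or are
-- opposite sides of a 4-cycle in a biclique; in a 4-vertex L_G the latter puts every edge into one
-- biclique and makes L_G complete. Each of the three graphs contradicts this description.
-- Conversely, in a claw-, diamond- and C4-free H every neighbourhood splits into two cliques;
-- gluing the ends of one root edge per vertex accordingly yields a graph G without triangles or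
-- 4-cycles, whose bicliques are its maximal stars, so that L_G is H. Both conditions pass to
-- induced subgraphs.

module Submission where

open import Defs
open import Axiom.UniquenessOfIdentityProofs using (module Decidable⇒UIP)
open import Data.Bool using (Bool; true; false; not; _∨_; if_then_else_)
open import Data.Bool.Properties using (¬-not; not-¬) renaming (_≟_ to _≟ᵇ_)
open import Data.Empty using (⊥; ⊥-elim)
open import Data.Fin using (Fin; zero; suc; _↑ˡ_; _↑ʳ_; splitAt)
open import Data.Fin.Properties using (_≟_; 0≢1+n; <-cmp; <-asym; <-irrelevant; all?; any?; splitAt-↑ˡ; splitAt-↑ʳ)
open import Data.List using (List; []; _∷_; allFin)
open import Data.List.Membership.Propositional using (_∈_)
open import Data.List.Membership.Propositional.Properties using (∈-allFin)
open import Data.List.Relation.Unary.Any using (here; there)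
open import Data.Maybe using (Maybe; just; nothing; maybe′)
import Data.Maybe as Maybe
open import Data.Maybe.Properties using (just-injective)
import Data.Nat as ℕ
open import Data.Product using (Σ; ∃; ∃-syntax; _×_; _,_; proj₁; proj₂)
open import Data.Sum using (_⊎_; inj₁; inj₂; [_,_]) renaming (swap to ⊎-swap)
open import Data.Vec using (Vec; []; _∷_; lookup)
open import Data.Vec.Relation.Unary.All using ([]; _∷_)
open import Data.Vec.Relation.Unary.AllPairs using ([]; _∷_)
open import Data.Vec.Relation.Unary.Unique.Propositional.Properties using (lookup-injective)
open import Function using (_∘_; case_of_)
open import Function.Bundles using (_⇔_; mk⇔; _⤖_; mk⤖; Bijection)
open import Function.Definitions using (Injective)
open import Relation.Binary using (tri<; tri≈; tri>)
open import Relation.Binary.PropositionalEquality using (_≡_; _≢_; refl; cong; subst; subst₂; module ≡-Reasoning)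
import Relation.Binary.PropositionalEquality as ≡
open import Relation.Binary.Structures using (IsDecEquivalence)
open import Relation.Nullary using (¬_; Dec; yes; no; does; ¬?; _×-dec_; _⊎-dec_; _→-dec_)
open import Relation.Nullary.Decidable using (dec-true; does-⇔; toWitness)

≡true⇒≢false : ∀ {b} → b ≡ true → b ≢ false
≡true⇒≢false refl ()

does-true⇒ : ∀ {A : Set} (a? : Dec A) → does a? ≡ true → A
does-true⇒ (yes a) _ = a
does-true⇒ (no _) ()

firstTrue : ∀ {k} → (Fin k → Bool) → Maybe (Fin k)
firstTrue {ℕ.zero} P = nothing
firstTrue {ℕ.suc k} P = if P zero then just zero else Maybe.map suc (firstTrue (P ∘ suc))

firstTrue-sound : ∀ {k} (P : Fin k → Bool) {q} → firstTrue P ≡ just q → P q ≡ true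
firstTrue-sound {ℕ.suc k} P h with P zero in P0
firstTrue-sound {ℕ.suc k} P refl | true = P0
... | false with firstTrue (P ∘ suc) in found
firstTrue-sound {ℕ.suc k} P refl | false | just q = firstTrue-sound (P ∘ suc) found

firstTrue-complete : ∀ {k} (P : Fin k → Bool) p → P p ≡ true → ∃ λ q → firstTrue P ≡ just q
firstTrue-complete {ℕ.suc k} P p h with P zero in P0
... | true = zero , refl
firstTrue-complete {ℕ.suc k} P zero h | false = ⊥-elim (≡true⇒≢false h P0)
firstTrue-complete {ℕ.suc k} P (suc p) h | false with firstTrue-complete (P ∘ suc) p h
... | q , found rewrite found = suc q , refl

firstTrue-cong : ∀ {k} {P Q : Fin k → Bool} → (∀ x → P x ≡ Q x) → firstTrue P ≡ firstTrue Q
firstTrue-cong {ℕ.zero} P≗Q = refl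
firstTrue-cong {ℕ.suc k} P≗Q rewrite P≗Q zero | firstTrue-cong (P≗Q ∘ suc) = refl

-- Models the quotient by _~_ inside Fin N: a class is represented by its first index.
module CanonicalRepresentative {A : Set} {N : ℕ.ℕ} (encode : A → Fin N) (decode : Fin N → A)
  (decode-encode : ∀ a → decode (encode a) ≡ a)
  {_~_ : A → A → Set} (~-isDecEquivalence : IsDecEquivalence _~_) where

  open IsDecEquivalence ~-isDecEquivalence
    renaming (refl to ~-refl; sym to ~-sym; trans to ~-trans; _≟_ to _~?_)

  private
    related : A → Fin N → Bool
    related a x = does (a ~? decode x)

    firstRelated : ∀ a → ∃ λ x → firstTrue (related a) ≡ just x
    firstRelated a = firstTrue-complete (related a) (encode a)
      (dec-true (a ~? decode (encode a)) (subst (a ~_) (≡.sym (decode-encode a)) ~-refl))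

  opaque
    rep : A → Fin N
    rep a = proj₁ (firstRelated a)

    rep-related : ∀ a → a ~ decode (rep a)
    rep-related a = does-true⇒ (a ~? _) (firstTrue-sound (related a) (proj₂ (firstRelated a)))

    rep-cong : ∀ {a b} → a ~ b → rep a ≡ rep b
    rep-cong {a} {b} a~b = just-injective (begin
      just (rep a)            ≡⟨ ≡.sym (proj₂ (firstRelated a)) ⟩
      firstTrue (related a)   ≡⟨ firstTrue-cong (λ x → does-⇔ same-class (a ~? decode x) (b ~? decode x)) ⟩
      firstTrue (related b)   ≡⟨ proj₂ (firstRelated b) ⟩
      just (rep b)            ∎)
      where
        open ≡-Reasoning
        same-class : ∀ {x} → (a ~ x) ⇔ (b ~ x)
        same-class = mk⇔ (~-trans (~-sym a~b)) (~-trans a~b)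

  rep-injective : ∀ {a b} → rep a ≡ rep b → a ~ b
  rep-injective {a} {b} eq =
    ~-trans (rep-related a) (~-sym (subst (λ x → b ~ decode x) (≡.sym eq) (rep-related b)))

module GraphFacts (G : Graph) where

  V : Set
  V = Fin (n G)

  adj-sym : ∀ {u v b} → adj G u v ≡ b → adj G v u ≡ b
  adj-sym {u} {v} a = ≡.trans (sym G v u) a

  adj⇒≢ : ∀ {u v} → adj G u v ≡ true → u ≢ v
  adj⇒≢ {u} a refl = ≡true⇒≢false a (irrefl G u)

  end₁ end₂ : Edge G → V
  end₁ e = proj₁ (proj₁ e)
  end₂ e = proj₂ (proj₁ e)

  data Joins (e : Edge G) (p q : V) : Set where
    ordered  : end₁ e ≡ p → end₂ e ≡ q → Joins e p q
    reversed : end₁ e ≡ q → end₂ e ≡ p → Joins e p q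

  Joins-ends : (e : Edge G) → Joins e (end₁ e) (end₂ e)
  Joins-ends e = ordered refl refl

  Joins-sym : ∀ {e p q} → Joins e p q → Joins e q p
  Joins-sym (ordered p q)  = reversed p q
  Joins-sym (reversed p q) = ordered p q

  Joins⇒adj : ∀ {e p q} → Joins e p q → adj G p q ≡ true
  Joins⇒adj {(_ , _ , a)} (ordered refl refl)  = a
  Joins⇒adj {(_ , _ , a)} (reversed refl refl) = adj-sym a

  Joins⇒≢ : ∀ {e p q} → Joins e p q → p ≢ q
  Joins⇒≢ = adj⇒≢ ∘ Joins⇒adj

  Joins-unique : ∀ {e p q r s} → Joins e p q → Joins e r s → (p ≡ r × q ≡ s) ⊎ (p ≡ s × q ≡ r)
  Joins-unique (ordered refl refl)  (ordered refl refl)  = inj₁ (refl , refl)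
  Joins-unique (ordered refl refl)  (reversed refl refl) = inj₂ (refl , refl)
  Joins-unique (reversed refl refl) (ordered refl refl)  = inj₂ (refl , refl)
  Joins-unique (reversed refl refl) (reversed refl refl) = inj₁ (refl , refl)

  Joins-endpoint : ∀ {e p q a b} → Joins e p q → Joins e a b → a ≡ p ⊎ a ≡ q
  Joins-endpoint j k with Joins-unique k j
  ... | inj₁ (a≡p , _) = inj₁ a≡p
  ... | inj₂ (a≡q , _) = inj₂ a≡q

  Joins-other : ∀ {e p q r} → Joins e p q → Joins e p r → q ≡ r
  Joins-other j k with Joins-unique j k
  ... | inj₁ (_ , q≡r)    = q≡r
  ... | inj₂ (p≡r , q≡p) = ≡.trans q≡p p≡r

  Joins-distinct : ∀ {e p q r s} → Joins e p r → Joins e q s → p ≢ q → Joins e p q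
  Joins-distinct j k p≢q with Joins-unique j k
  ... | inj₁ (p≡q , _)      = ⊥-elim (p≢q p≡q)
  ... | inj₂ (refl , refl) = j

  Edge-≡ : ∀ {e f} → end₁ e ≡ end₁ f → end₂ e ≡ end₂ f → e ≡ f
  Edge-≡ {(_ , l , a)} {(_ , l′ , a′)} refl refl
    rewrite <-irrelevant l l′ | Decidable⇒UIP.≡-irrelevant _≟ᵇ_ a a′ = refl

  Joins-injective : ∀ {e f p q} → Joins e p q → Joins f p q → e ≡ f
  Joins-injective (ordered refl refl)  (ordered e₁ e₂)  = Edge-≡ (≡.sym e₁) (≡.sym e₂)
  Joins-injective (reversed refl refl) (reversed e₁ e₂) = Edge-≡ (≡.sym e₁) (≡.sym e₂)
  Joins-injective {(_ , l , _)} {(_ , l′ , _)} (ordered refl refl)  (reversed refl refl) = ⊥-elim (<-asym l l′)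
  Joins-injective {(_ , l , _)} {(_ , l′ , _)} (reversed refl refl) (ordered refl refl)  = ⊥-elim (<-asym l l′)

  edgeBetween : ∀ {p q} → adj G p q ≡ true → ∃ λ e → Joins e p q
  edgeBetween {p} {q} a with <-cmp p q
  ... | tri< p<q _ _ = ((p , q) , p<q , a) , ordered refl refl
  ... | tri≈ _ p≡q _ = ⊥-elim (adj⇒≢ a p≡q)
  ... | tri> _ _ q<p = ((q , p) , q<p , adj-sym a) , reversed refl refl

  EdgeIn-intro : ∀ {e p q} (B : VSet G) → Joins e p q → p ∈ˢ B → q ∈ˢ B → EdgeIn G e B
  EdgeIn-intro B (ordered refl refl)  p∈B q∈B = p∈B , q∈B
  EdgeIn-intro B (reversed refl refl) p∈B q∈B = q∈B , p∈B

  EdgeIn-elim : ∀ {e p q} {B : VSet G} → EdgeIn G e B → Joins e p q → p ∈ˢ B × q ∈ˢ B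
  EdgeIn-elim (h₁ , h₂) (ordered refl refl)  = h₁ , h₂
  EdgeIn-elim (h₁ , h₂) (reversed refl refl) = h₂ , h₁

  _∪ˢ_ : VSet G → VSet G → VSet G
  (X ∪ˢ Y) u = X u ∨ Y u

  ∪ˢ-introˡ : ∀ {X Y u} → u ∈ˢ X → u ∈ˢ (X ∪ˢ Y)
  ∪ˢ-introˡ u∈X rewrite u∈X = refl

  ∪ˢ-introʳ : ∀ {X Y u} → u ∈ˢ Y → u ∈ˢ (X ∪ˢ Y)
  ∪ˢ-introʳ {X} {u = u} u∈Y with X u
  ... | true  = refl
  ... | false = u∈Y

  ∪ˢ-elim : ∀ {X Y u} → u ∈ˢ (X ∪ˢ Y) → u ∈ˢ X ⊎ u ∈ˢ Y
  ∪ˢ-elim {X} {u = u} h with X u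
  ... | true  = inj₁ refl
  ... | false = inj₂ h

  ∪ˢ-∉ : ∀ {X Y u} → (X ∪ˢ Y) u ≡ false → X u ≡ false × Y u ≡ false
  ∪ˢ-∉ {X} {Y} {u} h with X u | Y u
  ... | false | false = refl , refl

  insert : V → VSet G → VSet G
  insert w X u = X u ∨ does (u ≟ w)

  insert-∋ : ∀ {X} w → w ∈ˢ insert w X
  insert-∋ {X} w with X w | w ≟ w
  ... | true  | _     = refl
  ... | false | yes _ = refl
  ... | false | no w≢w = ⊥-elim (w≢w refl)

  insert-elim : ∀ {X w u} → u ∈ˢ insert w X → u ∈ˢ X ⊎ u ≡ w
  insert-elim {X} {w} {u} h with X u | u ≟ w
  ... | true  | _        = inj₁ refl
  ... | false | yes u≡w = inj₂ u≡w

  ⦅_,_⦆ : V → V → VSet G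
  ⦅ a , b ⦆ = insert b (insert a (λ _ → false))

  ⦅,⦆-elim : ∀ {a b u} → u ∈ˢ ⦅ a , b ⦆ → u ≡ a ⊎ u ≡ b
  ⦅,⦆-elim {a} {b} h with insert-elim {insert a (λ _ → false)} {b} h
  ... | inj₂ u≡b = inj₂ u≡b
  ... | inj₁ h′ with insert-elim {λ _ → false} {a} h′
  ...   | inj₂ u≡a = inj₁ u≡a
  ...   | inj₁ ()

  ⦅,⦆-∋ˡ : ∀ a b → a ∈ˢ ⦅ a , b ⦆
  ⦅,⦆-∋ˡ a b = ∪ˢ-introˡ {insert a (λ _ → false)} {λ u → does (u ≟ b)} {a} (insert-∋ {λ _ → false} a)

  ⦅,⦆-∋ʳ : ∀ a b → b ∈ˢ ⦅ a , b ⦆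
  ⦅,⦆-∋ʳ a b = insert-∋ {insert a (λ _ → false)} b

  record IsCompleteBipartition (X Y : VSet G) : Set where
    field
      disjoint      : ∀ {u} → u ∈ˢ X → Y u ≡ false
      complete      : ∀ {u v} → u ∈ˢ X → v ∈ˢ Y → adj G u v ≡ true
      X-independent : ∀ {u v} → u ∈ˢ X → v ∈ˢ X → adj G u v ≡ false
      Y-independent : ∀ {u v} → u ∈ˢ Y → v ∈ˢ Y → adj G u v ≡ false
      X-nonempty    : ∃[ x ] x ∈ˢ X
      Y-nonempty    : ∃[ y ] y ∈ˢ Y

    X-neighbour∈Y : ∀ {a b} → a ∈ˢ X → b ∈ˢ X ⊎ b ∈ˢ Y → adj G a b ≡ true → b ∈ˢ Y
    X-neighbour∈Y a∈X (inj₁ b∈X) ab = ⊥-elim (≡true⇒≢false ab (X-independent a∈X b∈X))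
    X-neighbour∈Y a∈X (inj₂ b∈Y) ab = b∈Y

    Y-neighbour∈X : ∀ {a b} → a ∈ˢ Y → b ∈ˢ X ⊎ b ∈ˢ Y → adj G a b ≡ true → b ∈ˢ X
    Y-neighbour∈X a∈Y (inj₁ b∈X) ab = b∈X
    Y-neighbour∈X a∈Y (inj₂ b∈Y) ab = ⊥-elim (≡true⇒≢false ab (Y-independent a∈Y b∈Y))

  swap : ∀ {X Y} → IsCompleteBipartition X Y → IsCompleteBipartition Y X
  swap c = record
    { disjoint      = λ u∈Y → ¬-not (λ u∈X → ≡true⇒≢false u∈Y (disjoint u∈X))
    ; complete      = λ u∈Y v∈X → adj-sym (complete v∈X u∈Y)
    ; X-independent = Y-independent
    ; Y-independent = X-independent
    ; X-nonempty    = Y-nonempty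
    ; Y-nonempty    = X-nonempty
    }
    where open IsCompleteBipartition c

  IsCompleteBipartition⇒IsCompleteBipartite : ∀ {X Y} → IsCompleteBipartition X Y →
                                              IsCompleteBipartite G (X ∪ˢ Y)
  IsCompleteBipartition⇒IsCompleteBipartite {X} {Y} c =
    X , Y , partition , (λ _ → ∪ˢ-introˡ {X} {Y}) , (λ _ → ∪ˢ-introʳ {X} {Y}) , X-nonempty , Y-nonempty ,
    λ u v u∈B v∈B → orient (partition u u∈B) (partition v v∈B) , unorient
    where
      open IsCompleteBipartition c
      Side : V → Set
      Side u = (u ∈ˢ X × ¬ u ∈ˢ Y) ⊎ (u ∈ˢ Y × ¬ u ∈ˢ X)
      partition : ∀ u → u ∈ˢ (X ∪ˢ Y) → Side u
      partition u h with ∪ˢ-elim {X} {Y} {u} h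
      ... | inj₁ u∈X = inj₁ (u∈X , λ u∈Y → ≡true⇒≢false u∈Y (disjoint u∈X))
      ... | inj₂ u∈Y = inj₂ (u∈Y , λ u∈X → ≡true⇒≢false u∈Y (disjoint u∈X))
      orient : ∀ {u v} → Side u → Side v → adj G u v ≡ true →
               (u ∈ˢ X × v ∈ˢ Y) ⊎ (u ∈ˢ Y × v ∈ˢ X)
      orient (inj₁ (u∈X , _)) (inj₁ (v∈X , _)) uv = ⊥-elim (≡true⇒≢false uv (X-independent u∈X v∈X))
      orient (inj₁ (u∈X , _)) (inj₂ (v∈Y , _)) uv = inj₁ (u∈X , v∈Y)
      orient (inj₂ (u∈Y , _)) (inj₁ (v∈X , _)) uv = inj₂ (u∈Y , v∈X)
      orient (inj₂ (u∈Y , _)) (inj₂ (v∈Y , _)) uv = ⊥-elim (≡true⇒≢false uv (Y-independent u∈Y v∈Y))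
      unorient : ∀ {u v} → (u ∈ˢ X × v ∈ˢ Y) ⊎ (u ∈ˢ Y × v ∈ˢ X) → adj G u v ≡ true
      unorient (inj₁ (u∈X , v∈Y)) = complete u∈X v∈Y
      unorient (inj₂ (u∈Y , v∈X)) = adj-sym (complete v∈X u∈Y)

  record Bipartition (B : VSet G) : Set where
    field
      X Y                   : VSet G
      isCompleteBipartition : IsCompleteBipartition X Y
      cover                 : ∀ {u} → u ∈ˢ B → u ∈ˢ X ⊎ u ∈ˢ Y

    open IsCompleteBipartition isCompleteBipartition public

    orient : ∀ {u v} → u ∈ˢ B → v ∈ˢ B → adj G u v ≡ true →
             (u ∈ˢ X × v ∈ˢ Y) ⊎ (u ∈ˢ Y × v ∈ˢ X)
    orient u∈B v∈B uv with cover u∈B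
    ... | inj₁ u∈X = inj₁ (u∈X , X-neighbour∈Y u∈X (cover v∈B) uv)
    ... | inj₂ u∈Y = inj₂ (u∈Y , Y-neighbour∈X u∈Y (cover v∈B) uv)

    common-neighbours-nonadjacent : ∀ {x y z} → x ∈ˢ B → y ∈ˢ B → z ∈ˢ B →
      adj G x y ≡ true → adj G x z ≡ true → adj G y z ≡ false
    common-neighbours-nonadjacent x∈B y∈B z∈B xy xz with orient x∈B y∈B xy | orient x∈B z∈B xz
    ... | inj₁ (_ , y∈Y)   | inj₁ (_ , z∈Y)   = Y-independent y∈Y z∈Y
    ... | inj₂ (_ , y∈X)   | inj₂ (_ , z∈X)   = X-independent y∈X z∈X
    ... | inj₁ (x∈X , _)   | inj₂ (x∈Y , _)   = ⊥-elim (≡true⇒≢false x∈Y (disjoint x∈X))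
    ... | inj₂ (x∈Y , _)   | inj₁ (x∈X , _)   = ⊥-elim (≡true⇒≢false x∈Y (disjoint x∈X))

    edges-cross : ∀ {x y a b} → x ∈ˢ B → y ∈ˢ B → a ∈ˢ B → b ∈ˢ B →
      adj G x y ≡ true → adj G a b ≡ true →
      (adj G x b ≡ true × adj G y a ≡ true) ⊎ (adj G x a ≡ true × adj G y b ≡ true)
    edges-cross x∈B y∈B a∈B b∈B xy ab with orient x∈B y∈B xy | orient a∈B b∈B ab
    ... | inj₁ (x∈X , y∈Y) | inj₁ (a∈X , b∈Y) = inj₁ (complete x∈X b∈Y , adj-sym (complete a∈X y∈Y))
    ... | inj₁ (x∈X , y∈Y) | inj₂ (a∈Y , b∈X) = inj₂ (complete x∈X a∈Y , adj-sym (complete b∈X y∈Y))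
    ... | inj₂ (x∈Y , y∈X) | inj₁ (a∈X , b∈Y) = inj₂ (adj-sym (complete a∈X x∈Y) , complete y∈X b∈Y)
    ... | inj₂ (x∈Y , y∈X) | inj₂ (a∈Y , b∈X) = inj₁ (adj-sym (complete b∈X x∈Y) , complete y∈X a∈Y)

  bipartition : ∀ {B} → IsCompleteBipartite G B → Bipartition B
  bipartition {B} (X , Y , partition , X⊆B , Y⊆B , X-nonempty , Y-nonempty , adj-iff) = record
    { X = X
    ; Y = Y
    ; cover = cover
    ; isCompleteBipartition = record
      { disjoint      = disjoint
      ; complete      = λ {u} {v} u∈X v∈Y →
                          proj₂ (adj-iff u v (X⊆B u u∈X) (Y⊆B v v∈Y)) (inj₁ (u∈X , v∈Y))
      ; X-independent = X-independent
      ; Y-independent = Y-independent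
      ; X-nonempty    = X-nonempty
      ; Y-nonempty    = Y-nonempty
      }
    }
    where
      cover : ∀ {u} → u ∈ˢ B → u ∈ˢ X ⊎ u ∈ˢ Y
      cover {u} u∈B with partition u u∈B
      ... | inj₁ (u∈X , _) = inj₁ u∈X
      ... | inj₂ (u∈Y , _) = inj₂ u∈Y
      disjoint : ∀ {u} → u ∈ˢ X → Y u ≡ false
      disjoint {u} u∈X with partition u (X⊆B u u∈X)
      ... | inj₁ (_ , u∉Y) = ¬-not u∉Y
      ... | inj₂ (_ , u∉X) = ⊥-elim (u∉X u∈X)
      disjointʸ : ∀ {u} → u ∈ˢ Y → X u ≡ false
      disjointʸ u∈Y = ¬-not (λ u∈X → ≡true⇒≢false u∈Y (disjoint u∈X))
      X-independent : ∀ {u v} → u ∈ˢ X → v ∈ˢ X → adj G u v ≡ false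
      X-independent {u} {v} u∈X v∈X = ¬-not λ uv →
        case proj₁ (adj-iff u v (X⊆B u u∈X) (X⊆B v v∈X)) uv of λ where
          (inj₁ (_ , v∈Y)) → ≡true⇒≢false v∈Y (disjoint v∈X)
          (inj₂ (u∈Y , _)) → ≡true⇒≢false u∈Y (disjoint u∈X)
      Y-independent : ∀ {u v} → u ∈ˢ Y → v ∈ˢ Y → adj G u v ≡ false
      Y-independent {u} {v} u∈Y v∈Y = ¬-not λ uv →
        case proj₁ (adj-iff u v (Y⊆B u u∈Y) (Y⊆B v v∈Y)) uv of λ where
          (inj₁ (u∈X , _)) → ≡true⇒≢false u∈X (disjointʸ u∈Y)
          (inj₂ (_ , v∈X)) → ≡true⇒≢false v∈X (disjointʸ v∈Y)

  Attachable : VSet G → VSet G → V → Set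
  Attachable X Y w = (∀ u → u ∈ˢ Y → adj G w u ≡ true) × (∀ u → u ∈ˢ X → adj G w u ≡ false)

  attachable? : ∀ X Y w → Dec (Attachable X Y w)
  attachable? X Y w = all? (λ u → (Y u ≟ᵇ true) →-dec (adj G w u ≟ᵇ true))
                ×-dec all? (λ u → (X u ≟ᵇ true) →-dec (adj G w u ≟ᵇ false))

  Attachable-anti : ∀ {X Y X′ Y′ w} → X ⊆ˢ X′ → Y ⊆ˢ Y′ → Attachable X′ Y′ w → Attachable X Y w
  Attachable-anti X⊆X′ Y⊆Y′ (toY , notX) = (λ u → toY u ∘ Y⊆Y′ u) , (λ u → notX u ∘ X⊆X′ u)

  attach : ∀ {X Y w} → IsCompleteBipartition X Y → Attachable X Y w → Y w ≡ false →
           IsCompleteBipartition (insert w X) Y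
  attach {X} {Y} {w} c (toY , notX) w∉Y = record
    { disjoint      = disjoint′
    ; complete      = complete′
    ; X-independent = X-independent′
    ; Y-independent = Y-independent
    ; X-nonempty    = w , insert-∋ {X} w
    ; Y-nonempty    = Y-nonempty
    }
    where
      open IsCompleteBipartition c
      disjoint′ : ∀ {u} → u ∈ˢ insert w X → Y u ≡ false
      disjoint′ h with insert-elim {X} {w} h
      ... | inj₁ u∈X = disjoint u∈X
      ... | inj₂ refl = w∉Y
      complete′ : ∀ {u v} → u ∈ˢ insert w X → v ∈ˢ Y → adj G u v ≡ true
      complete′ {v = v} h v∈Y with insert-elim {X} {w} h
      ... | inj₁ u∈X = complete u∈X v∈Y
      ... | inj₂ refl = toY v v∈Y
      X-independent′ : ∀ {u v} → u ∈ˢ insert w X → v ∈ˢ insert w X → adj G u v ≡ false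
      X-independent′ {u} {v} hu hv with insert-elim {X} {w} hu | insert-elim {X} {w} hv
      ... | inj₁ u∈X  | inj₁ v∈X  = X-independent u∈X v∈X
      ... | inj₁ u∈X  | inj₂ refl = adj-sym (notX u u∈X)
      ... | inj₂ refl | inj₁ v∈X  = notX v v∈X
      ... | inj₂ refl | inj₂ refl = irrefl G w

  Sides : Set
  Sides = VSet G × VSet G

  _⊑_ : Sides → Sides → Set
  (X , Y) ⊑ (X′ , Y′) = X ⊆ˢ X′ × Y ⊆ˢ Y′

  ⊑-refl : ∀ {s} → s ⊑ s
  ⊑-refl = (λ _ h → h) , (λ _ h → h)

  ⊑-trans : ∀ {s t r} → s ⊑ t → t ⊑ r → s ⊑ r
  ⊑-trans (X⊆ , Y⊆) (X⊆′ , Y⊆′) = (λ u → X⊆′ u ∘ X⊆ u) , (λ u → Y⊆′ u ∘ Y⊆ u)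

  IsCompleteBipartitionˢ : Sides → Set
  IsCompleteBipartitionˢ (X , Y) = IsCompleteBipartition X Y

  _∈ᵖ_ : V → Sides → Set
  w ∈ᵖ (X , Y) = w ∈ˢ (X ∪ˢ Y)

  ∈ᵖ-mono : ∀ {s t w} → s ⊑ t → w ∈ᵖ s → w ∈ᵖ t
  ∈ᵖ-mono {X , Y} {X′ , Y′} (X⊆ , Y⊆) h with ∪ˢ-elim {X} {Y} h
  ... | inj₁ w∈X = ∪ˢ-introˡ {X′} {Y′} (X⊆ _ w∈X)
  ... | inj₂ w∈Y = ∪ˢ-introʳ {X′} {Y′} (Y⊆ _ w∈Y)

  stepWith : (X Y : VSet G) (w : V) → Bool → Dec (Attachable X Y w) → Dec (Attachable Y X w) → Sides
  stepWith X Y w true  _       _       = X , Y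
  stepWith X Y w false (yes _) _       = insert w X , Y
  stepWith X Y w false (no _)  (yes _) = X , insert w Y
  stepWith X Y w false (no _)  (no _)  = X , Y

  step : V → Sides → Sides
  step w (X , Y) = stepWith X Y w ((X ∪ˢ Y) w) (attachable? X Y w) (attachable? Y X w)

  saturate : List V → Sides → Sides
  saturate []       s = s
  saturate (w ∷ ws) s = saturate ws (step w s)

  step-preserves : ∀ w s → IsCompleteBipartitionˢ s → IsCompleteBipartitionˢ (step w s)
  step-preserves w (X , Y) = go ((X ∪ˢ Y) w) refl (attachable? X Y w) (attachable? Y X w)
    where
      go : ∀ b → (X ∪ˢ Y) w ≡ b → (d₁ : Dec (Attachable X Y w)) (d₂ : Dec (Attachable Y X w)) →
           IsCompleteBipartition X Y → IsCompleteBipartitionˢ (stepWith X Y w b d₁ d₂)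
      go true  _ _         _         c = c
      go false w∉ (yes at) _         c = attach c at (proj₂ (∪ˢ-∉ {X} {Y} w∉))
      go false w∉ (no _)   (yes at)  c = swap (attach (swap c) at (proj₁ (∪ˢ-∉ {X} {Y} w∉)))
      go false _  (no _)   (no _)    c = c

  step-⊒ : ∀ w s → s ⊑ step w s
  step-⊒ w (X , Y) = go ((X ∪ˢ Y) w) (attachable? X Y w) (attachable? Y X w)
    where
      go : ∀ b (d₁ : Dec (Attachable X Y w)) (d₂ : Dec (Attachable Y X w)) → (X , Y) ⊑ stepWith X Y w b d₁ d₂
      go true  _       _       = ⊑-refl
      go false (yes _) _       = (λ _ → ∪ˢ-introˡ {X} {λ u → does (u ≟ w)}) , (λ _ h → h)
      go false (no _)  (yes _) = (λ _ h → h) , (λ _ → ∪ˢ-introˡ {Y} {λ u → does (u ≟ w)})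
      go false (no _)  (no _)  = ⊑-refl

  step-absorbs : ∀ w s → Attachable (proj₁ s) (proj₂ s) w ⊎ Attachable (proj₂ s) (proj₁ s) w →
                 w ∈ᵖ step w s
  step-absorbs w (X , Y) = go ((X ∪ˢ Y) w) refl (attachable? X Y w) (attachable? Y X w)
    where
      go : ∀ b → (X ∪ˢ Y) w ≡ b → (d₁ : Dec (Attachable X Y w)) (d₂ : Dec (Attachable Y X w)) →
           Attachable X Y w ⊎ Attachable Y X w → w ∈ᵖ stepWith X Y w b d₁ d₂
      go true  w∈ _       _        _          = w∈
      go false _  (yes _) _        _          = ∪ˢ-introˡ {insert w X} {Y} (insert-∋ {X} w)
      go false _  (no _)  (yes _)  _          = ∪ˢ-introʳ {X} {insert w Y} (insert-∋ {Y} w)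
      go false _  (no ¬a) (no _)   (inj₁ a)   = ⊥-elim (¬a a)
      go false _  (no _)  (no ¬a)  (inj₂ a)   = ⊥-elim (¬a a)

  saturate-preserves : ∀ ws s → IsCompleteBipartitionˢ s → IsCompleteBipartitionˢ (saturate ws s)
  saturate-preserves []       s c = c
  saturate-preserves (w ∷ ws) s c = saturate-preserves ws (step w s) (step-preserves w s c)

  saturate-⊒ : ∀ ws s → s ⊑ saturate ws s
  saturate-⊒ []       s = ⊑-refl
  saturate-⊒ (w ∷ ws) s = ⊑-trans (step-⊒ w s) (saturate-⊒ ws (step w s))

  -- Attachability only shrinks as the sides grow.
  saturate-absorbs : ∀ ws s {w} → w ∈ ws →
    let (X , Y) = saturate ws s in Attachable X Y w ⊎ Attachable Y X w → w ∈ᵖ saturate ws s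
  saturate-absorbs (w ∷ ws) s (here refl) at =
    ∈ᵖ-mono (saturate-⊒ ws (step w s)) (step-absorbs w s (earlier at))
    where
      final = saturate (w ∷ ws) s
      s⊑ = saturate-⊒ (w ∷ ws) s
      earlier : Attachable (proj₁ final) (proj₂ final) w ⊎ Attachable (proj₂ final) (proj₁ final) w →
                Attachable (proj₁ s) (proj₂ s) w ⊎ Attachable (proj₂ s) (proj₁ s) w
      earlier (inj₁ a) = inj₁ (Attachable-anti (proj₁ s⊑) (proj₂ s⊑) a)
      earlier (inj₂ a) = inj₂ (Attachable-anti (proj₂ s⊑) (proj₁ s⊑) a)
  saturate-absorbs (_ ∷ ws) s (there w∈ws) at = saturate-absorbs ws _ w∈ws at

  module _ {X Y X′ Y′ x₀} (c : IsCompleteBipartition X Y) (c′ : IsCompleteBipartition X′ Y′)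
    (cover : ∀ {v} → v ∈ˢ (X ∪ˢ Y) → v ∈ˢ X′ ⊎ v ∈ˢ Y′) (x₀∈X : x₀ ∈ˢ X) (x₀∈X′ : x₀ ∈ˢ X′) where
    private
      module C = IsCompleteBipartition c
      module C′ = IsCompleteBipartition c′

      Y⊆Y′ : ∀ {v} → v ∈ˢ Y → v ∈ˢ Y′
      Y⊆Y′ v∈Y = C′.X-neighbour∈Y x₀∈X′ (cover (∪ˢ-introʳ {X} {Y} v∈Y)) (C.complete x₀∈X v∈Y)

      X⊆X′ : ∀ {v} → v ∈ˢ X → v ∈ˢ X′
      X⊆X′ v∈X = C′.Y-neighbour∈X (Y⊆Y′ y₀∈Y) (cover (∪ˢ-introˡ {X} {Y} v∈X)) (adj-sym (C.complete v∈X y₀∈Y))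
        where y₀∈Y = proj₂ C.Y-nonempty

    attachable-in-larger : ∀ {u} → u ∈ˢ X′ ⊎ u ∈ˢ Y′ → Attachable X Y u ⊎ Attachable Y X u
    attachable-in-larger (inj₁ u∈X′) =
      inj₁ ((λ v v∈Y → C′.complete u∈X′ (Y⊆Y′ v∈Y)) , (λ v v∈X → C′.X-independent u∈X′ (X⊆X′ v∈X)))
    attachable-in-larger (inj₂ u∈Y′) =
      inj₂ ((λ v v∈X → adj-sym (C′.complete (X⊆X′ v∈X) u∈Y′)) , (λ v v∈Y → C′.Y-independent u∈Y′ (Y⊆Y′ v∈Y)))

  -- Saturate greedily; any complete bipartite B′ ⊇ B has sides extending ours, so each of its
  -- vertices was attachable when it was processed.
  biclique-⊇ : ∀ {X Y} → IsCompleteBipartition X Y → ∃ λ B → IsBiclique G B × X ⊆ˢ B × Y ⊆ˢ B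
  biclique-⊇ {X} {Y} c =
    (X* ∪ˢ Y*) , (IsCompleteBipartition⇒IsCompleteBipartite c* , maximal) ,
    (λ _ h → ∈ᵖ-mono s⊑s* (∪ˢ-introˡ {X} {Y} h)) , (λ _ h → ∈ᵖ-mono s⊑s* (∪ˢ-introʳ {X} {Y} h))
    where
      vertices = allFin (n G)
      X* = proj₁ (saturate vertices (X , Y))
      Y* = proj₂ (saturate vertices (X , Y))
      c* = saturate-preserves vertices (X , Y) c
      s⊑s* = saturate-⊒ vertices (X , Y)
      x₀ = proj₁ (IsCompleteBipartition.X-nonempty c*)
      x₀∈X* = proj₂ (IsCompleteBipartition.X-nonempty c*)
      maximal : ∀ B′ → IsCompleteBipartite G B′ → (X* ∪ˢ Y*) ⊆ˢ B′ → B′ ⊆ˢ (X* ∪ˢ Y*)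
      maximal B′ cb′ B⊆B′ u u∈B′ = saturate-absorbs vertices (X , Y) (∈-allFin u) (attachable (cover′ x₀∈*))
        where
          open Bipartition (bipartition cb′) using (cover; isCompleteBipartition) renaming (X to X′; Y to Y′)
          x₀∈* = ∪ˢ-introˡ {X*} {Y*} x₀∈X*
          cover′ : ∀ {v} → v ∈ˢ (X* ∪ˢ Y*) → v ∈ˢ X′ ⊎ v ∈ˢ Y′
          cover′ {v} v∈ = cover (B⊆B′ v v∈)
          attachable : x₀ ∈ˢ X′ ⊎ x₀ ∈ˢ Y′ → Attachable X* Y* u ⊎ Attachable Y* X* u
          attachable (inj₁ x₀∈X′) = attachable-in-larger c* isCompleteBipartition cover′ x₀∈X* x₀∈X′ (cover u∈B′)
          attachable (inj₂ x₀∈Y′) = attachable-in-larger c* (swap isCompleteBipartition) (⊎-swap ∘ cover′)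
                                      x₀∈X* x₀∈Y′ (⊎-swap (cover u∈B′))

  ⦅,⦆-independent : ∀ {a b u v} → adj G a b ≡ false → u ∈ˢ ⦅ a , b ⦆ → v ∈ˢ ⦅ a , b ⦆ → adj G u v ≡ false
  ⦅,⦆-independent {a} {b} {u} {v} ab u∈ v∈ with ⦅,⦆-elim {a} {b} {u} u∈ | ⦅,⦆-elim {a} {b} {v} v∈
  ... | inj₁ refl | inj₁ refl = irrefl G a
  ... | inj₁ refl | inj₂ refl = ab
  ... | inj₂ refl | inj₁ refl = adj-sym ab
  ... | inj₂ refl | inj₂ refl = irrefl G _

  LAdj-square : ∀ {e f p₁ q₁ p₂ q₂} → e ≢ f → Joins e p₁ q₁ → Joins f p₂ q₂ →
    adj G p₁ q₂ ≡ true → adj G p₂ q₁ ≡ true → adj G p₁ p₂ ≡ false → adj G q₁ q₂ ≡ false → LAdj G e f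
  LAdj-square {e} {f} {p₁} {q₁} {p₂} {q₂} e≢f je jf p₁q₂ p₂q₁ p₁p₂ q₁q₂ =
    e≢f , B , biclique , EdgeIn-intro B je (P⊆B p₁ (⦅,⦆-∋ˡ p₁ p₂)) (Q⊆B q₁ (⦅,⦆-∋ˡ q₁ q₂))
                       , EdgeIn-intro B jf (P⊆B p₂ (⦅,⦆-∋ʳ p₁ p₂)) (Q⊆B q₂ (⦅,⦆-∋ʳ q₁ q₂))
    where
      complete : ∀ {u v} → u ∈ˢ ⦅ p₁ , p₂ ⦆ → v ∈ˢ ⦅ q₁ , q₂ ⦆ → adj G u v ≡ true
      complete {u} {v} u∈ v∈ with ⦅,⦆-elim {p₁} {p₂} {u} u∈ | ⦅,⦆-elim {q₁} {q₂} {v} v∈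
      ... | inj₁ refl | inj₁ refl = Joins⇒adj je
      ... | inj₁ refl | inj₂ refl = p₁q₂
      ... | inj₂ refl | inj₁ refl = p₂q₁
      ... | inj₂ refl | inj₂ refl = Joins⇒adj jf
      square : IsCompleteBipartition ⦅ p₁ , p₂ ⦆ ⦅ q₁ , q₂ ⦆
      square = record
        { disjoint      = λ {u} u∈P → ¬-not λ u∈Q → adj⇒≢ (complete {u} {u} u∈P u∈Q) refl
        ; complete      = complete
        ; X-independent = ⦅,⦆-independent p₁p₂
        ; Y-independent = ⦅,⦆-independent q₁q₂
        ; X-nonempty    = p₁ , ⦅,⦆-∋ˡ p₁ p₂
        ; Y-nonempty    = q₁ , ⦅,⦆-∋ˡ q₁ q₂
        }
      B = proj₁ (biclique-⊇ square)
      biclique = proj₁ (proj₂ (biclique-⊇ square))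
      P⊆B = proj₁ (proj₂ (proj₂ (biclique-⊇ square)))
      Q⊆B = proj₂ (proj₂ (proj₂ (biclique-⊇ square)))

  LAdj-wedge : ∀ {e f x y z} → e ≢ f → Joins e x y → Joins f x z → adj G y z ≡ false → LAdj G e f
  LAdj-wedge {x = x} e≢f je jf yz = LAdj-square e≢f je jf (Joins⇒adj jf) (Joins⇒adj je) (irrefl G x) yz

  LAdj-wedge-nonadjacent : ∀ {e f x y z} → LAdj G e f → Joins e x y → Joins f x z → adj G y z ≡ false
  LAdj-wedge-nonadjacent (_ , B , biclique , e∈B , f∈B) je jf =
    Bipartition.common-neighbours-nonadjacent (bipartition (proj₁ biclique))
      x∈B y∈B (proj₂ (EdgeIn-elim f∈B jf)) (Joins⇒adj je) (Joins⇒adj jf)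
    where
      x∈B = proj₁ (EdgeIn-elim e∈B je)
      y∈B = proj₂ (EdgeIn-elim e∈B je)

  SharedEndpoint : Edge G → Edge G → Set
  SharedEndpoint e f = Σ V λ x → Σ V λ y → Σ V λ z → Joins e x y × Joins f x z

  Disjoint : Edge G → Edge G → Set
  Disjoint e f = end₁ e ≢ end₁ f × end₁ e ≢ end₂ f × end₂ e ≢ end₁ f × end₂ e ≢ end₂ f

  sharedEndpoint? : ∀ e f → SharedEndpoint e f ⊎ Disjoint e f
  sharedEndpoint? e f with end₁ e ≟ end₁ f | end₁ e ≟ end₂ f | end₂ e ≟ end₁ f | end₂ e ≟ end₂ f
  ... | yes eq | _      | _      | _      = inj₁ (_ , _ , _ , Joins-ends e , ordered (≡.sym eq) refl)
  ... | no _   | yes eq | _      | _      = inj₁ (_ , _ , _ , Joins-ends e , reversed refl (≡.sym eq))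
  ... | no _   | no _   | yes eq | _      = inj₁ (_ , _ , _ , Joins-sym (Joins-ends e) , ordered (≡.sym eq) refl)
  ... | no _   | no _   | no _   | yes eq = inj₁ (_ , _ , _ , Joins-sym (Joins-ends e) , reversed refl (≡.sym eq))
  ... | no a   | no b   | no c   | no d   = inj₂ (a , b , c , d)

  EdgeIn-cross : ∀ {B e f} → IsCompleteBipartite G B → EdgeIn G e B → EdgeIn G f B →
    (adj G (end₁ e) (end₂ f) ≡ true × adj G (end₂ e) (end₁ f) ≡ true) ⊎
    (adj G (end₁ e) (end₁ f) ≡ true × adj G (end₂ e) (end₂ f) ≡ true)
  EdgeIn-cross {e = e} {f} cb (x∈B , y∈B) (a∈B , b∈B) =
    Bipartition.edges-cross (bipartition cb) x∈B y∈B a∈B b∈B (proj₂ (proj₂ e)) (proj₂ (proj₂ f))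

  SquareFree : Set
  SquareFree = ∀ {a b c d} → adj G a b ≡ true → adj G b c ≡ true → adj G c d ≡ true → adj G d a ≡ true →
               a ≢ c → b ≢ d → ⊥

  LAdj⇒SharedEndpoint : SquareFree → ∀ {e f} → LAdj G e f → SharedEndpoint e f
  LAdj⇒SharedEndpoint square-free {e} {f} (_ , B , biclique , e∈B , f∈B) with sharedEndpoint? e f
  ... | inj₁ shared = shared
  ... | inj₂ (xa , xb , ya , yb) with EdgeIn-cross {B} {e} {f} (proj₁ biclique) e∈B f∈B
  ...   | inj₁ (xb~ , ya~) = ⊥-elim (square-free (proj₂ (proj₂ e)) ya~ (proj₂ (proj₂ f)) (adj-sym xb~) xa yb)
  ...   | inj₂ (xa~ , yb~) = ⊥-elim (square-free (proj₂ (proj₂ e)) yb~ (adj-sym (proj₂ (proj₂ f))) (adj-sym xa~) xb ya)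

pattern v₀ = zero
pattern v₁ = suc zero
pattern v₂ = suc (suc zero)
pattern v₃ = suc (suc (suc zero))

-- Checked by evaluating the decision procedure on all 4⁵ inputs; opaque so that
-- type checking its uses never repeats that evaluation.
opaque
  Fin4-exhausted : ∀ (a b c d k : Fin 4) → a ≢ b → a ≢ c → a ≢ d → b ≢ c → b ≢ d → c ≢ d →
                   k ≡ a ⊎ k ≡ b ⊎ k ≡ c ⊎ k ≡ d
  Fin4-exhausted = toWitness {a? = all? λ a → all? λ b → all? λ c → all? λ d → all? λ k →
    ¬? (a ≟ b) →-dec ¬? (a ≟ c) →-dec ¬? (a ≟ d) →-dec ¬? (b ≟ c) →-dec ¬? (b ≟ d) →-dec ¬? (c ≟ d) →-dec
    (k ≟ a ⊎-dec k ≟ b ⊎-dec k ≟ c ⊎-dec k ≟ d)} _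

Fin4-all : ∀ {P : Fin 4 → Set} {a b c d} → a ≢ b → a ≢ c → a ≢ d → b ≢ c → b ≢ d → c ≢ d →
           P a → P b → P c → P d → ∀ k → P k
Fin4-all {P} {a} {b} {c} {d} ab ac ad bc bd cd pa pb pc pd k with Fin4-exhausted a b c d k ab ac ad bc bd cd
... | inj₁ refl               = pa
... | inj₂ (inj₁ refl)        = pb
... | inj₂ (inj₂ (inj₁ refl)) = pc
... | inj₂ (inj₂ (inj₂ refl)) = pd

module RootOfFourVertexGraph (adjF : Fin 4 → Fin 4 → Bool) {p₀ q₀ : Fin 4} (p₀≢q₀ : p₀ ≢ q₀)
  (p₀≁q₀ : adjF p₀ q₀ ≡ false) (G : Graph) (φ : Fin 4 ⤖ Edge G)
  (φ-adj : ∀ u v → (adjF u v ≡ true → LAdj G (Bijection.to φ u) (Bijection.to φ v))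
                 × (LAdj G (Bijection.to φ u) (Bijection.to φ v) → adjF u v ≡ true)) where
  open GraphFacts G public

  E : Fin 4 → Edge G
  E = Bijection.to φ

  E-injective : ∀ {i j} → E i ≡ E j → i ≡ j
  E-injective = Bijection.injective φ

  index : ∀ {a b} → adj G a b ≡ true → ∃ λ k → Joins (E k) a b
  index ab with edgeBetween ab
  ... | e , j with Bijection.surjective φ e
  ...   | k , E≡ = k , subst (λ f → Joins f _ _) (≡.sym (E≡ refl)) j

  index-≢ : ∀ {i j a b c d} → Joins (E i) a b → Joins (E j) c d → a ≢ c → a ≢ d → i ≢ j
  index-≢ ji jj a≢c a≢d refl with Joins-unique ji jj
  ... | inj₁ (a≡c , _) = a≢c a≡c
  ... | inj₂ (a≡d , _) = a≢d a≡d

  index-unique : ∀ {i j x y} → Joins (E i) x y → Joins (E j) x y → i ≡ j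
  index-unique ji jj = E-injective (Joins-injective ji jj)

  -- All four edges of G would lie in B, making p₀ and q₀ adjacent.
  ¬square-in-biclique : ∀ {u v x y p q} (B : VSet G) → IsBiclique G B →
    Joins (E u) x y → Joins (E v) p q → x ∈ˢ B → y ∈ˢ B → p ∈ˢ B → q ∈ˢ B →
    adj G x p ≡ true → adj G y q ≡ true → x ≢ p → x ≢ q → y ≢ p → y ≢ q → ⊥
  ¬square-in-biclique {u} {v} {x} {y} {p} {q} B biclique ju jv x∈B y∈B p∈B q∈B xp yq x≢p x≢q y≢p y≢q =
    ≡true⇒≢false (proj₂ (φ-adj p₀ q₀) (p₀≢q₀ ∘ E-injective , B , biclique , all p₀ , all q₀)) p₀≁q₀
    where
      g = proj₁ (index xp)
      jg = proj₂ (index xp)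
      h = proj₁ (index yq)
      jh = proj₂ (index yq)
      all : ∀ k → EdgeIn G (E k) B
      all = Fin4-all
        (index-≢ ju jv x≢p x≢q)
        (index-≢ (Joins-sym ju) jg (Joins⇒≢ ju ∘ ≡.sym) y≢p)
        (index-≢ ju jh (Joins⇒≢ ju) x≢q)
        (index-≢ (Joins-sym jv) jg (x≢q ∘ ≡.sym) (Joins⇒≢ jv ∘ ≡.sym))
        (index-≢ jv jh (y≢p ∘ ≡.sym) (Joins⇒≢ jv))
        (index-≢ jg jh (Joins⇒≢ ju) x≢q)
        (EdgeIn-intro B ju x∈B y∈B) (EdgeIn-intro B jv p∈B q∈B)
        (EdgeIn-intro B jg x∈B p∈B) (EdgeIn-intro B jh y∈B q∈B)

  ¬LAdj-Disjoint : ∀ {u v} → LAdj G (E u) (E v) → ¬ Disjoint (E u) (E v)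
  ¬LAdj-Disjoint {u} {v} (_ , B , biclique , (x∈B , y∈B) , (a∈B , b∈B)) (x≢a , x≢b , y≢a , y≢b)
    with EdgeIn-cross {B} {E u} {E v} (proj₁ biclique) (x∈B , y∈B) (a∈B , b∈B)
  ... | inj₁ (xb , ya) = ¬square-in-biclique B biclique (Joins-ends (E u)) (Joins-sym (Joins-ends (E v)))
                           x∈B y∈B b∈B a∈B xb ya x≢b x≢a y≢b y≢a
  ... | inj₂ (xa , yb) = ¬square-in-biclique B biclique (Joins-ends (E u)) (Joins-ends (E v))
                           x∈B y∈B a∈B b∈B xa yb x≢a x≢b y≢a y≢b

  Wedge : Fin 4 → Fin 4 → Set
  Wedge u v = Σ V λ x → Σ V λ y → Σ V λ z → Joins (E u) x y × Joins (E v) x z × adj G y z ≡ false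

  adjacent⇒wedge : ∀ {u v} → adjF u v ≡ true → Wedge u v
  adjacent⇒wedge {u} {v} uv with proj₁ (φ-adj u v) uv | sharedEndpoint? (E u) (E v)
  ... | ladj | inj₁ (x , y , z , ju , jv) = x , y , z , ju , jv , LAdj-wedge-nonadjacent ladj ju jv
  ... | ladj | inj₂ disjoint = ⊥-elim (¬LAdj-Disjoint ladj disjoint)

  square⇒adjacent : ∀ {u v p₁ q₁ p₂ q₂} → u ≢ v → Joins (E u) p₁ q₁ → Joins (E v) p₂ q₂ →
    adj G p₁ q₂ ≡ true → adj G p₂ q₁ ≡ true → adj G p₁ p₂ ≡ false → adj G q₁ q₂ ≡ false → adjF u v ≡ true
  square⇒adjacent {u} {v} u≢v ju jv p₁q₂ p₂q₁ p₁p₂ q₁q₂ =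
    proj₂ (φ-adj u v) (LAdj-square (u≢v ∘ E-injective) ju jv p₁q₂ p₂q₁ p₁p₂ q₁q₂)

  wedge⇒adjacent : ∀ {u v x y z} → u ≢ v → Joins (E u) x y → Joins (E v) x z → adj G y z ≡ false → adjF u v ≡ true
  wedge⇒adjacent {u} {v} u≢v ju jv yz = proj₂ (φ-adj u v) (LAdj-wedge (u≢v ∘ E-injective) ju jv yz)

  nonadjacent⇒triangle : ∀ {u v x y z} → u ≢ v → adjF u v ≡ false →
    Joins (E u) x y → Joins (E v) x z → adj G y z ≡ true
  nonadjacent⇒triangle {y = y} {z} u≢v u≁v ju jv with adj G y z in yz
  ... | true  = refl
  ... | false = ⊥-elim (≡true⇒≢false (wedge⇒adjacent u≢v ju jv yz) u≁v)

  Branch : Fin 4 → V → V → Set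
  Branch i x y = Σ V λ z → Joins (E i) x z × adj G y z ≡ false

  Incident : Fin 4 → V → Set
  Incident i x = Σ V λ w → Joins (E i) x w

  adjacent⇒incident : ∀ {u v p q} → adjF u v ≡ true → Joins (E u) p q → Incident v p ⊎ Incident v q
  adjacent⇒incident uv jᵤ with adjacent⇒wedge uv
  ... | a , _ , c , jᵤ′ , jᵥ , _ with Joins-endpoint jᵤ jᵤ′
  ...   | inj₁ refl = inj₁ (c , jᵥ)
  ...   | inj₂ refl = inj₂ (c , jᵥ)

  wedge⇒branch : ∀ {u i x y} → Joins (E u) x y → Wedge u i → Branch i x y ⊎ Branch i y x
  wedge⇒branch ju (a , b , c , ja , jc , bc) with Joins-unique ju ja
  ... | inj₁ (refl , refl) = inj₁ (c , jc , bc)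
  ... | inj₂ (refl , refl) = inj₂ (c , jc , bc)


module ClawRoot (root : IsBicliqueLineGraph claw) where
  G : Graph
  G = proj₁ root

  open RootOfFourVertexGraph clawAdj {v₁} {v₂} (λ ()) refl G (proj₁ (proj₂ root)) (proj₂ (proj₂ root))

  leaves-nonadjacent : ∀ {i j} → i ≢ v₀ → j ≢ v₀ → clawAdj i j ≡ false
  leaves-nonadjacent {v₀} i≢0 _ = ⊥-elim (i≢0 refl)
  leaves-nonadjacent {suc _} {v₀} _ j≢0 = ⊥-elim (j≢0 refl)
  leaves-nonadjacent {v₁} {v₁} _ _ = refl
  leaves-nonadjacent {v₁} {v₂} _ _ = refl
  leaves-nonadjacent {v₁} {v₃} _ _ = refl
  leaves-nonadjacent {v₂} {v₁} _ _ = refl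
  leaves-nonadjacent {v₂} {v₂} _ _ = refl
  leaves-nonadjacent {v₂} {v₃} _ _ = refl
  leaves-nonadjacent {v₃} {v₁} _ _ = refl
  leaves-nonadjacent {v₃} {v₂} _ _ = refl
  leaves-nonadjacent {v₃} {v₃} _ _ = refl

  centre-adjacent : ∀ {k} → k ≢ v₀ → clawAdj v₀ k ≡ true
  centre-adjacent {v₀} k≢0 = ⊥-elim (k≢0 refl)
  centre-adjacent {v₁} _ = refl
  centre-adjacent {v₂} _ = refl
  centre-adjacent {v₃} _ = refl

  -- The far ends of two leaf edges at the same end x of the centre edge are adjacent, and the
  -- edge between them is a third leaf edge missing the centre edge.
  ¬two-branches : ∀ {i j x y} → i ≢ j → i ≢ v₀ → j ≢ v₀ → Joins (E v₀) x y → Branch i x y → Branch j x y → ⊥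
  ¬two-branches {i} {j} {x} {y} i≢j i≢0 j≢0 j₀ (zᵢ , jᵢ , _) (zⱼ , jⱼ , _) =
    misses (wedge⇒branch j₀ (adjacent⇒wedge (centre-adjacent k≢0)))
    where
      zᵢzⱼ = nonadjacent⇒triangle i≢j (leaves-nonadjacent i≢0 j≢0) jᵢ jⱼ
      k = proj₁ (index zᵢzⱼ)
      jₖ = proj₂ (index zᵢzⱼ)
      zᵢ≢x : zᵢ ≢ x
      zᵢ≢x = Joins⇒≢ jᵢ ∘ ≡.sym
      zⱼ≢x : zⱼ ≢ x
      zⱼ≢x = Joins⇒≢ jⱼ ∘ ≡.sym
      zᵢ≢y : zᵢ ≢ y
      zᵢ≢y refl = i≢0 (index-unique jᵢ j₀)
      zⱼ≢y : zⱼ ≢ y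
      zⱼ≢y refl = j≢0 (index-unique jⱼ j₀)
      k≢0 : k ≢ v₀
      k≢0 = index-≢ jₖ j₀ zᵢ≢x zᵢ≢y
      endpoint-of-k : ∀ {w w′} → Joins (E k) w w′ → w ≢ x × w ≢ y
      endpoint-of-k jw with Joins-endpoint jₖ jw
      ... | inj₁ refl = zᵢ≢x , zᵢ≢y
      ... | inj₂ refl = zⱼ≢x , zⱼ≢y
      misses : Branch k x y ⊎ Branch k y x → ⊥
      misses (inj₁ (_ , jw , _)) = proj₁ (endpoint-of-k jw) refl
      misses (inj₂ (_ , jw , _)) = proj₂ (endpoint-of-k jw) refl

  -- Among the three leaf edges, two branch off the same end of the centre edge.
  contradiction : ⊥
  contradiction = pigeon (branch v₁ refl) (branch v₂ refl) (branch v₃ refl)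
    where
      x = end₁ (E v₀)
      y = end₂ (E v₀)
      j₀ = Joins-ends (E v₀)
      Branches : Fin 4 → Set
      Branches i = Branch i x y ⊎ Branch i y x
      branch : ∀ i → clawAdj v₀ i ≡ true → Branches i
      branch i a = wedge⇒branch j₀ (adjacent⇒wedge a)
      pigeon : Branches v₁ → Branches v₂ → Branches v₃ → ⊥
      pigeon (inj₁ a) (inj₁ b) _        = ¬two-branches (λ ()) (λ ()) (λ ()) j₀ a b
      pigeon (inj₂ a) (inj₂ b) _        = ¬two-branches (λ ()) (λ ()) (λ ()) (Joins-sym j₀) a b
      pigeon (inj₁ a) (inj₂ b) (inj₁ c) = ¬two-branches (λ ()) (λ ()) (λ ()) j₀ a c
      pigeon (inj₁ a) (inj₂ b) (inj₂ c) = ¬two-branches (λ ()) (λ ()) (λ ()) (Joins-sym j₀) b c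
      pigeon (inj₂ a) (inj₁ b) (inj₁ c) = ¬two-branches (λ ()) (λ ()) (λ ()) j₀ b c
      pigeon (inj₂ a) (inj₁ b) (inj₂ c) = ¬two-branches (λ ()) (λ ()) (λ ()) (Joins-sym j₀) a c

module DiamondRoot (root : IsBicliqueLineGraph diamond) where
  G : Graph
  G = proj₁ root

  open RootOfFourVertexGraph diamondAdj {v₂} {v₃} (λ ()) refl G (proj₁ (proj₂ root)) (proj₂ (proj₂ root))

  through-centre : ∀ {i x y z} → diamondAdj v₀ i ≡ true → diamondAdj v₁ i ≡ true →
    Joins (E v₀) x y → Joins (E v₁) x z → adj G y z ≡ false → Incident i x
  through-centre {y = y} {z} a₀ a₁ j₀ j₁ yz with adjacent⇒incident a₀ j₀ | adjacent⇒incident a₁ j₁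
  ... | inj₁ through-x | _             = through-x
  ... | inj₂ _         | inj₁ through-x = through-x
  ... | inj₂ (_ , jy)  | inj₂ (_ , jz)  = ⊥-elim (≡true⇒≢false (Joins⇒adj (Joins-distinct jy jz y≢z)) yz)
    where
      y≢z : y ≢ z
      y≢z refl = 0≢1+n (index-unique j₀ j₁)

  -- All four edges pass through x, yet E v₂ and E v₃ close a triangle whose third edge misses x.
  contradiction : ⊥
  contradiction with adjacent⇒wedge {v₀} {v₁} refl
  ... | x , y , z , j₀ , j₁ , yz = misses (incident k)
    where
      incident : ∀ k → Incident k x
      incident v₀ = y , j₀
      incident v₁ = z , j₁
      incident v₂ = through-centre refl refl j₀ j₁ yz
      incident v₃ = through-centre refl refl j₀ j₁ yz
      j₂ = proj₂ (incident v₂)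
      j₃ = proj₂ (incident v₃)
      w₂w₃ = nonadjacent⇒triangle (λ ()) refl j₂ j₃
      k = proj₁ (index w₂w₃)
      misses : Incident k x → ⊥
      misses (_ , jₖ) with Joins-endpoint (proj₂ (index w₂w₃)) jₖ
      ... | inj₁ x≡w₂ = Joins⇒≢ j₂ x≡w₂
      ... | inj₂ x≡w₃ = Joins⇒≢ j₃ x≡w₃

module C4Root (root : IsBicliqueLineGraph C4) where
  G : Graph
  G = proj₁ root

  open RootOfFourVertexGraph c4Adj {v₀} {v₂} (λ ()) refl G (proj₁ (proj₂ root)) (proj₂ (proj₂ root))

  -- The far ends of E v₁ = xz and E v₃ = xw are joined by an edge avoiding x; it can only be E v₂,
  -- which then meets E v₁ at z, and that wedge forces x ≁ w.
  ¬same-end : ∀ {x y z w} → Joins (E v₀) x y → Joins (E v₁) x z → Joins (E v₃) x w → ⊥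
  ¬same-end {x} {y} {z} {w} j₀ j₁ j₃ = misses (index zw)
    where
      zw = nonadjacent⇒triangle (λ ()) refl j₁ j₃
      misses-x : ∀ {k} → Joins (E k) z w → ¬ Incident k x
      misses-x jₖ (_ , jₓ) with Joins-endpoint jₖ jₓ
      ... | inj₁ x≡z = Joins⇒≢ j₁ x≡z
      ... | inj₂ x≡w = Joins⇒≢ j₃ x≡w
      misses : (∃ λ k → Joins (E k) z w) → ⊥
      misses (v₀ , jₖ) = misses-x jₖ (y , j₀)
      misses (v₁ , jₖ) = misses-x jₖ (z , j₁)
      misses (v₃ , jₖ) = misses-x jₖ (w , j₃)
      misses (v₂ , jₖ) with adjacent⇒wedge {v₁} {v₂} refl
      ... | a , b , c , j₁′ , j₂′ , bc with Joins-endpoint j₁ j₁′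
      ...   | inj₁ refl = misses-x jₖ (c , j₂′)
      ...   | inj₂ refl with Joins-other (Joins-sym j₁) j₁′ | Joins-other jₖ j₂′
      ...     | refl | refl = ≡true⇒≢false (Joins⇒adj j₃) bc

  -- E v₂ meets both E v₁ = xz and E v₃ = yw; the only consistent choice E v₂ = zw makes E v₀ and
  -- E v₂ opposite sides of an induced 4-cycle, hence adjacent.
  ¬opposite-ends : ∀ {x y z w} → Joins (E v₀) x y → Joins (E v₁) x z → adj G y z ≡ false →
                   Joins (E v₃) y w → adj G x w ≡ false → ⊥
  ¬opposite-ends {x} {y} {z} {w} j₀ j₁ yz j₃ xw =
    meet (adjacent⇒incident {v₁} {v₂} refl j₁) (adjacent⇒incident {v₃} {v₂} refl j₃)
    where
      x≢y : x ≢ y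
      x≢y = Joins⇒≢ j₀
      x≢w : x ≢ w
      x≢w refl = 0≢1+n (≡.sym (index-unique (Joins-sym j₃) j₀))
      z≢y : z ≢ y
      z≢y refl = 0≢1+n (index-unique j₀ j₁)
      z≢w : z ≢ w
      z≢w refl = ≡true⇒≢false (Joins⇒adj j₃) yz
      meet : Incident v₂ x ⊎ Incident v₂ z → Incident v₂ y ⊎ Incident v₂ w → ⊥
      meet (inj₁ (_ , p)) (inj₁ (_ , q)) = 0≢1+n (≡.sym (index-unique (Joins-distinct p q x≢y) j₀))
      meet (inj₁ (_ , p)) (inj₂ (_ , q)) = ≡true⇒≢false (Joins⇒adj (Joins-distinct p q x≢w)) xw
      meet (inj₂ (_ , p)) (inj₁ (_ , q)) = ≡true⇒≢false (Joins⇒adj (Joins-sym (Joins-distinct p q z≢y))) yz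
      meet (inj₂ (_ , p)) (inj₂ (_ , q)) = ≡true⇒≢false (square⇒adjacent {v₀} {v₂} (λ ()) j₀
        (Joins-sym (Joins-distinct p q z≢w)) (Joins⇒adj j₁) (Joins⇒adj (Joins-sym j₃)) xw yz) refl

  contradiction : ⊥
  contradiction with adjacent⇒wedge {v₀} {v₁} refl
  ... | x , y , z , j₀ , j₁ , yz with wedge⇒branch j₀ (adjacent⇒wedge {v₀} {v₃} refl)
  ...   | inj₁ (w , j₃ , _)  = ¬same-end j₀ j₁ j₃
  ...   | inj₂ (w , j₃ , xw) = ¬opposite-ends j₀ j₁ yz j₃ xw

module InducedFourVertex (H : Graph) where
  open GraphFacts H using (adj-sym; adj⇒≢)

  induced₄ : (adjF : Fin 4 → Fin 4 → Bool) → (∀ u v → adjF u v ≡ adjF v u) → (∀ u → adjF u u ≡ false) →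
    (a b c d : Fin (n H)) → a ≢ b → a ≢ c → a ≢ d → b ≢ c → b ≢ d → c ≢ d →
    adj H a b ≡ adjF v₀ v₁ → adj H a c ≡ adjF v₀ v₂ → adj H a d ≡ adjF v₀ v₃ →
    adj H b c ≡ adjF v₁ v₂ → adj H b d ≡ adjF v₁ v₃ → adj H c d ≡ adjF v₂ v₃ →
    Σ (Fin 4 → Fin (n H)) λ g → Injective _≡_ _≡_ g × (∀ i j → adj H (g i) (g j) ≡ adjF i j)
  induced₄ adjF adjF-sym adjF-irrefl a b c d a≢b a≢c a≢d b≢c b≢d c≢d ab ac ad bc bd cd =
    g , lookup-injective distinct _ _ , g-adj
    where
      vertices : Vec (Fin (n H)) 4
      vertices = a ∷ b ∷ c ∷ d ∷ []
      distinct = (a≢b ∷ a≢c ∷ a≢d ∷ []) ∷ (b≢c ∷ b≢d ∷ []) ∷ (c≢d ∷ []) ∷ [] ∷ []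
      g : Fin 4 → Fin (n H)
      g = lookup vertices
      flip : ∀ {u v i j} → adj H u v ≡ adjF i j → adj H v u ≡ adjF j i
      flip {i = i} {j} h = ≡.trans (adj-sym h) (adjF-sym i j)
      diagonal : ∀ i → adj H (g i) (g i) ≡ adjF i i
      diagonal i = ≡.trans (irrefl H (g i)) (≡.sym (adjF-irrefl i))
      g-adj : ∀ i j → adj H (g i) (g j) ≡ adjF i j
      g-adj v₀ v₁ = ab
      g-adj v₀ v₂ = ac
      g-adj v₀ v₃ = ad
      g-adj v₁ v₂ = bc
      g-adj v₁ v₃ = bd
      g-adj v₂ v₃ = cd
      g-adj v₁ v₀ = flip ab
      g-adj v₂ v₀ = flip ac
      g-adj v₃ v₀ = flip ad
      g-adj v₂ v₁ = flip bc
      g-adj v₃ v₁ = flip bd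
      g-adj v₃ v₂ = flip cd
      g-adj v₀ v₀ = diagonal v₀
      g-adj v₁ v₁ = diagonal v₁
      g-adj v₂ v₂ = diagonal v₂
      g-adj v₃ v₃ = diagonal v₃

  claw-at : ∀ {c l₁ l₂ l₃} → adj H c l₁ ≡ true → adj H c l₂ ≡ true → adj H c l₃ ≡ true →
    adj H l₁ l₂ ≡ false → adj H l₁ l₃ ≡ false → adj H l₂ l₃ ≡ false →
    l₁ ≢ l₂ → l₁ ≢ l₃ → l₂ ≢ l₃ → ContainsInduced H claw
  claw-at {c} {l₁} {l₂} {l₃} cl₁ cl₂ cl₃ l₁l₂ l₁l₃ l₂l₃ l₁≢l₂ l₁≢l₃ l₂≢l₃ =
    induced₄ clawAdj (sym claw) (irrefl claw) c l₁ l₂ l₃ (adj⇒≢ cl₁) (adj⇒≢ cl₂) (adj⇒≢ cl₃)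
      l₁≢l₂ l₁≢l₃ l₂≢l₃ cl₁ cl₂ cl₃ l₁l₂ l₁l₃ l₂l₃

  diamond-at : ∀ {a b c d} → adj H a b ≡ true → adj H a c ≡ true → adj H a d ≡ true →
    adj H b c ≡ true → adj H b d ≡ true → adj H c d ≡ false → c ≢ d → ContainsInduced H diamond
  diamond-at {a} {b} {c} {d} ab ac ad bc bd cd c≢d =
    induced₄ diamondAdj (sym diamond) (irrefl diamond) a b c d (adj⇒≢ ab) (adj⇒≢ ac) (adj⇒≢ ad)
      (adj⇒≢ bc) (adj⇒≢ bd) c≢d ab ac ad bc bd cd

  C4-at : ∀ {a b c d} → adj H a b ≡ true → adj H b c ≡ true → adj H c d ≡ true → adj H d a ≡ true →
    adj H a c ≡ false → adj H b d ≡ false → a ≢ c → b ≢ d → ContainsInduced H C4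
  C4-at {a} {b} {c} {d} ab bc cd da ac bd a≢c b≢d =
    induced₄ c4Adj (sym C4) (irrefl C4) a b c d (adj⇒≢ ab) a≢c (adj⇒≢ da ∘ ≡.sym)
      (adj⇒≢ bc) b≢d (adj⇒≢ cd) ab ac (adj-sym da) bc bd cd

module LineGraphRoot (H : Graph) (claw-free : ¬ ContainsInduced H claw)
  (diamond-free : ¬ ContainsInduced H diamond) (C4-free : ¬ ContainsInduced H C4) where
  open GraphFacts H using (adj-sym; adj⇒≢)
  open InducedFourVertex H

  W : Set
  W = Fin (n H)

  -- Claw- and diamond-freeness split the neighbourhood of i into two cliques, that of its first
  -- neighbour and the rest; side i j names the one containing j.
  side : W → W → Bool
  side i j = maybe′ (λ m → does (j ≟ m) ∨ adj H j m) false (firstTrue (adj H i))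

  data Position (m j : W) : Bool → Set where
    at-m   : j ≡ m → Position m j true
    near-m : j ≢ m → adj H j m ≡ true → Position m j true
    far-m  : j ≢ m → adj H j m ≡ false → Position m j false

  position : ∀ m j → Position m j (does (j ≟ m) ∨ adj H j m)
  position m j with j ≟ m
  ... | yes j≡m = at-m j≡m
  ... | no j≢m with adj H j m in jm
  ...   | true  = near-m j≢m jm
  ...   | false = far-m j≢m jm

  same-position⇔adjacent : ∀ {i m j k bj bk} → adj H i m ≡ true → adj H i j ≡ true → adj H i k ≡ true →
    j ≢ k → Position m j bj → Position m k bk → (bj ≡ bk → adj H j k ≡ true) × (adj H j k ≡ true → bj ≡ bk)
  same-position⇔adjacent im ij ik j≢k (at-m refl) (at-m refl) = ⊥-elim (j≢k refl)
  same-position⇔adjacent im ij ik j≢k (at-m refl) (near-m _ km) = (λ _ → adj-sym km) , (λ _ → refl)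
  same-position⇔adjacent im ij ik j≢k (near-m _ jm) (at-m refl) = (λ _ → jm) , (λ _ → refl)
  same-position⇔adjacent im ij ik j≢k (at-m refl) (far-m _ km) = (λ ()) , (λ jk → ⊥-elim (≡true⇒≢false jk (adj-sym km)))
  same-position⇔adjacent im ij ik j≢k (far-m _ jm) (at-m refl) = (λ ()) , (λ jk → ⊥-elim (≡true⇒≢false jk jm))
  same-position⇔adjacent {j = j} {k} im ij ik j≢k (near-m _ jm) (near-m _ km) = (λ _ → adjacent) , (λ _ → refl)
    where
      adjacent : adj H j k ≡ true
      adjacent with adj H j k in jk
      ... | true  = refl
      ... | false = ⊥-elim (diamond-free (diamond-at im ij ik (adj-sym jm) (adj-sym km) jk j≢k))
  same-position⇔adjacent im ij ik j≢k (near-m _ jm) (far-m k≢m km) = (λ ()) ,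
    λ jk → ⊥-elim (diamond-free (diamond-at ij im ik jm jk (adj-sym km) (k≢m ∘ ≡.sym)))
  same-position⇔adjacent im ij ik j≢k (far-m j≢m jm) (near-m _ km) = (λ ()) ,
    λ jk → ⊥-elim (diamond-free (diamond-at ik im ij km (adj-sym jk) (adj-sym jm) (j≢m ∘ ≡.sym)))
  same-position⇔adjacent {j = j} {k} im ij ik j≢k (far-m j≢m jm) (far-m k≢m km) = (λ _ → adjacent) , (λ _ → refl)
    where
      adjacent : adj H j k ≡ true
      adjacent with adj H j k in jk
      ... | true  = refl
      ... | false = ⊥-elim (claw-free (claw-at im ij ik (adj-sym jm) (adj-sym km) jk
                                        (j≢m ∘ ≡.sym) (k≢m ∘ ≡.sym) j≢k))

  same-side⇔adjacent : ∀ {i j k} → adj H i j ≡ true → adj H i k ≡ true → j ≢ k →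
    (side i j ≡ side i k → adj H j k ≡ true) × (adj H j k ≡ true → side i j ≡ side i k)
  same-side⇔adjacent {i} {j} {k} ij ik j≢k with firstTrue-complete (adj H i) j ij
  ... | m , found with firstTrue-sound (adj H i) found
  ...   | im rewrite found = same-position⇔adjacent im ij ik j≢k (position m j) (position m k)

  different-side⇒nonadjacent : ∀ {i j k} → adj H i j ≡ true → adj H i k ≡ true → j ≢ k →
    side i j ≢ side i k → adj H j k ≡ false
  different-side⇒nonadjacent ij ik j≢k sides = ¬-not (sides ∘ proj₂ (same-side⇔adjacent ij ik j≢k))

  Point : Set
  Point = W × Bool

  -- (i , s) is the end on side s of the root edge of i; adjacent vertices share the facing ends.
  _≈_ : Point → Point → Set
  (i , s) ≈ (j , t) = (i ≡ j × s ≡ t) ⊎ (adj H i j ≡ true × side i j ≡ s × side j i ≡ t)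

  ≈-sym : ∀ {p q} → p ≈ q → q ≈ p
  ≈-sym (inj₁ (refl , refl))       = inj₁ (refl , refl)
  ≈-sym (inj₂ (ij , sij , sji)) = inj₂ (adj-sym ij , sji , sij)

  ≈-trans : ∀ {p q r} → p ≈ q → q ≈ r → p ≈ r
  ≈-trans (inj₁ (refl , refl)) q≈r = q≈r
  ≈-trans p≈q (inj₁ (refl , refl)) = p≈q
  ≈-trans {i , s} {j , t} {k , u} (inj₂ (ij , sij , sji)) (inj₂ (jk , sjk , skj)) with i ≟ k
  ... | yes refl = inj₁ (refl , ≡.trans (≡.sym sij) skj)
  ... | no i≢k   = inj₂ (ik , ≡.trans (≡.sym side-at-i) sij , ≡.trans side-at-k skj)
    where
      ik : adj H i k ≡ true
      ik = proj₁ (same-side⇔adjacent (adj-sym ij) jk i≢k) (≡.trans sji (≡.sym sjk))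
      side-at-i : side i j ≡ side i k
      side-at-i = proj₂ (same-side⇔adjacent ij ik (adj⇒≢ jk)) jk
      side-at-k : side k i ≡ side k j
      side-at-k = proj₂ (same-side⇔adjacent (adj-sym ik) (adj-sym jk) (adj⇒≢ ij)) ij

  ≈-isDecEquivalence : IsDecEquivalence _≈_
  ≈-isDecEquivalence = record
    { isEquivalence = record { refl = inj₁ (refl , refl) ; sym = ≈-sym ; trans = ≈-trans }
    ; _≟_ = λ { (i , s) (j , t) → ((i ≟ j) ×-dec (s ≟ᵇ t))
                                ⊎-dec ((adj H i j ≟ᵇ true) ×-dec (side i j ≟ᵇ s) ×-dec (side j i ≟ᵇ t)) }
    }

  N : ℕ.ℕ
  N = n H ℕ.+ n H

  encode : Point → Fin N
  encode (i , false) = i ↑ˡ n H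
  encode (i , true)  = n H ↑ʳ i

  decode : Fin N → Point
  decode a = [ (_, false) , (_, true) ] (splitAt (n H) a)

  decode-encode : ∀ p → decode (encode p) ≡ p
  decode-encode (i , false) rewrite splitAt-↑ˡ (n H) i (n H) = refl
  decode-encode (i , true)  rewrite splitAt-↑ʳ (n H) (n H) i = refl

  open CanonicalRepresentative encode decode decode-encode ≈-isDecEquivalence

  rep-same-vertex : ∀ {i s t} → rep (i , s) ≡ rep (i , t) → s ≡ t
  rep-same-vertex eq with rep-injective eq
  ... | inj₁ (_ , s≡t) = s≡t
  ... | inj₂ (ii , _)  = ⊥-elim (adj⇒≢ ii refl)

  rep-meet : ∀ {i j s t} → rep (i , s) ≡ rep (j , t) → i ≢ j → adj H i j ≡ true × side i j ≡ s × side j i ≡ t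
  rep-meet eq i≢j with rep-injective eq
  ... | inj₁ (i≡j , _) = ⊥-elim (i≢j i≡j)
  ... | inj₂ meet      = meet

  RootEdge : W → Fin N → Fin N → Set
  RootEdge i a b = (rep (i , false) ≡ a × rep (i , true) ≡ b) ⊎ (rep (i , true) ≡ a × rep (i , false) ≡ b)

  rootEdge? : ∀ i a b → Dec (RootEdge i a b)
  rootEdge? i a b = ((rep (i , false) ≟ a) ×-dec (rep (i , true) ≟ b))
             ⊎-dec ((rep (i , true) ≟ a) ×-dec (rep (i , false) ≟ b))

  RootEdge-sym : ∀ {i a b} → RootEdge i a b → RootEdge i b a
  RootEdge-sym (inj₁ (p , q)) = inj₂ (q , p)
  RootEdge-sym (inj₂ (p , q)) = inj₁ (q , p)

  adjᴳ : Fin N → Fin N → Bool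
  adjᴳ a b = does (any? λ i → rootEdge? i a b)

  adjᴳ-intro : ∀ {i a b} → RootEdge i a b → adjᴳ a b ≡ true
  adjᴳ-intro {i} {a} {b} e = dec-true (any? λ i → rootEdge? i a b) (i , e)

  adjᴳ-elim : ∀ {a b} → adjᴳ a b ≡ true → ∃ λ i → RootEdge i a b
  adjᴳ-elim {a} {b} = does-true⇒ (any? λ i → rootEdge? i a b)

  adjᴳ-symmetric : ∀ a b → adjᴳ a b ≡ adjᴳ b a
  adjᴳ-symmetric a b = does-⇔ (mk⇔ flip flip) (any? λ i → rootEdge? i a b) (any? λ i → rootEdge? i b a)
    where
      flip : ∀ {a b} → ∃ (λ i → RootEdge i a b) → ∃ (λ i → RootEdge i b a)
      flip (i , e) = i , RootEdge-sym e

  rep-true≢false : ∀ {i} → rep (i , false) ≢ rep (i , true)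
  rep-true≢false eq with rep-same-vertex eq
  ... | ()

  adjᴳ-irrefl : ∀ a → adjᴳ a a ≡ false
  adjᴳ-irrefl a = ¬-not λ aa → loop (adjᴳ-elim aa)
    where
      loop : ∃ (λ i → RootEdge i a a) → ⊥
      loop (i , inj₁ (p , q)) = rep-true≢false (≡.trans p (≡.sym q))
      loop (i , inj₂ (p , q)) = rep-true≢false (≡.trans q (≡.sym p))

  G : Graph
  G = record { n = N ; adj = adjᴳ ; sym = adjᴳ-symmetric ; irrefl = adjᴳ-irrefl }

  open GraphFacts G hiding (V) renaming (adj-sym to adjᴳ-sym; adj⇒≢ to adjᴳ⇒≢)

  E : W → Edge G
  E i = proj₁ (edgeBetween (adjᴳ-intro {i} (inj₁ (refl , refl))))

  E-joins : ∀ i s → Joins (E i) (rep (i , s)) (rep (i , not s))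
  E-joins i false = proj₂ (edgeBetween (adjᴳ-intro {i} (inj₁ (refl , refl))))
  E-joins i true  = Joins-sym (E-joins i false)

  E-endpoint : ∀ {u x w} → Joins (E u) x w → ∃ λ s → rep (u , s) ≡ x
  E-endpoint {u} j with Joins-endpoint (E-joins u false) j
  ... | inj₁ x≡ = false , ≡.sym x≡
  ... | inj₂ x≡ = true , ≡.sym x≡

  adjᴳ-witness : ∀ {a b} → adjᴳ a b ≡ true → ∃ λ i → ∃ λ s → rep (i , s) ≡ a × rep (i , not s) ≡ b
  adjᴳ-witness ab with adjᴳ-elim ab
  ... | i , inj₁ (p , q) = i , false , p , q
  ... | i , inj₂ (p , q) = i , true , p , q

  rep-opposite : ∀ {i s t a b c} → rep (i , s) ≡ a → rep (i , not s) ≡ b →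
                 rep (i , t) ≡ b → rep (i , not t) ≡ c → a ≡ c
  rep-opposite {i} {s} {t} p q r u with rep-same-vertex (≡.trans q (≡.sym r))
  rep-opposite {i} {false} {true} p q r u | refl = ≡.trans (≡.sym p) u
  rep-opposite {i} {true} {false} p q r u | refl = ≡.trans (≡.sym p) u

  not≢id : ∀ {s} → not s ≢ s
  not≢id = not-¬ refl ∘ ≡.sym

  -- The root edges of a triangle come from pairwise adjacent i, j, k; then j and k lie on the
  -- same side of i, while the shared ends put them on opposite sides.
  triangle-free : ∀ {a b c} → adjᴳ a b ≡ true → adjᴳ b c ≡ true → adjᴳ c a ≡ true → ⊥
  triangle-free ab bc ca with adjᴳ-witness ab | adjᴳ-witness bc | adjᴳ-witness ca
  ... | i , s , p₁ , p₂ | j , t , p₃ , p₄ | k , r , p₅ , p₆ with i ≟ j | j ≟ k | k ≟ i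
  ... | yes refl | _        | _        = adjᴳ⇒≢ ca (≡.sym (rep-opposite p₁ p₂ p₃ p₄))
  ... | no _     | yes refl | _        = adjᴳ⇒≢ ab (≡.sym (rep-opposite p₃ p₄ p₅ p₆))
  ... | no _     | no _     | yes refl = adjᴳ⇒≢ bc (≡.sym (rep-opposite p₅ p₆ p₁ p₂))
  ... | no i≢j   | no j≢k   | no k≢i   =
    not≢id (≡.trans (≡.sym (proj₁ (proj₂ at-b))) (≡.trans same (proj₂ (proj₂ at-a))))
    where
      at-b = rep-meet (≡.trans p₂ (≡.sym p₃)) i≢j
      at-c = rep-meet (≡.trans p₄ (≡.sym p₅)) j≢k
      at-a = rep-meet (≡.trans p₆ (≡.sym p₁)) k≢i
      same : side i j ≡ side i k
      same = proj₂ (same-side⇔adjacent (proj₁ at-b) (adj-sym (proj₁ at-a)) j≢k) (proj₁ at-c)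

  -- A 4-cycle of root edges comes from a 4-cycle i j k l of H, induced because at each of its
  -- vertices the two cycle neighbours lie on opposite sides.
  square-free : SquareFree
  square-free ab bc cd da a≢c b≢d with adjᴳ-witness ab | adjᴳ-witness bc | adjᴳ-witness cd | adjᴳ-witness da
  ... | i , s , p₁ , p₂ | j , t , p₃ , p₄ | k , r , p₅ , p₆ | l , q , p₇ , p₈ with i ≟ j | j ≟ k | k ≟ l | l ≟ i
  ... | yes refl | _        | _        | _        = a≢c (rep-opposite p₁ p₂ p₃ p₄)
  ... | no _     | yes refl | _        | _        = b≢d (rep-opposite p₃ p₄ p₅ p₆)
  ... | no _     | no _     | yes refl | _        = a≢c (≡.sym (rep-opposite p₅ p₆ p₇ p₈))
  ... | no _     | no _     | no _     | yes refl = b≢d (≡.sym (rep-opposite p₇ p₈ p₁ p₂))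
  ... | no i≢j   | no j≢k   | no k≢l   | no l≢i   = square (j ≟ l) (i ≟ k)
    where
      at-b = rep-meet (≡.trans p₂ (≡.sym p₃)) i≢j
      at-c = rep-meet (≡.trans p₄ (≡.sym p₅)) j≢k
      at-d = rep-meet (≡.trans p₆ (≡.sym p₇)) k≢l
      at-a = rep-meet (≡.trans p₈ (≡.sym p₁)) l≢i
      ij = proj₁ at-b
      i-sides : side i j ≢ side i l
      i-sides eq = not≢id (≡.trans (≡.sym (proj₁ (proj₂ at-b))) (≡.trans eq (proj₂ (proj₂ at-a))))
      j-sides : side j i ≢ side j k
      j-sides eq = not≢id (≡.sym (≡.trans (≡.sym (proj₂ (proj₂ at-b))) (≡.trans eq (proj₁ (proj₂ at-c)))))
      square : Dec (j ≡ l) → Dec (i ≡ k) → ⊥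
      square (yes refl) _          = i-sides refl
      square (no _)     (yes refl) = j-sides refl
      square (no j≢l)   (no i≢k)   =
        C4-free (C4-at ij (proj₁ at-c) (proj₁ at-d) (proj₁ at-a)
                  (different-side⇒nonadjacent (adj-sym ij) (proj₁ at-c) i≢k j-sides)
                  (different-side⇒nonadjacent ij (adj-sym (proj₁ at-a)) j≢l i-sides) i≢k j≢l)

  side-at : ∀ {u v s t} → rep (u , s) ≡ rep (v , t) → u ≢ v → side u v ≡ s
  side-at eq u≢v = proj₁ (proj₂ (rep-meet eq u≢v))

  -- Distinct u, v sharing both root-edge ends would put v on both sides of u.
  E-injective : ∀ {u v} → E u ≡ E v → u ≡ v
  E-injective {u} {v} eq with u ≟ v
  ... | yes u≡v = u≡v
  ... | no u≢v with Joins-unique (E-joins u false) (subst (λ e → Joins e (rep (v , false)) (rep (v , true))) (≡.sym eq) (E-joins v false))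
  ...   | inj₁ (p , q) = ⊥-elim (≡true⇒≢false (side-at q u≢v) (side-at p u≢v))
  ...   | inj₂ (p , q) = ⊥-elim (≡true⇒≢false (side-at q u≢v) (side-at p u≢v))

  E-surjective : ∀ e → ∃ λ i → E i ≡ e
  E-surjective e with adjᴳ-witness (proj₂ (proj₂ e))
  ... | i , s , p , q = i , Joins-injective (subst₂ (Joins (E i)) p q (E-joins i s)) (Joins-ends e)

  adjacent⇔LAdj : ∀ u v → (adj H u v ≡ true → LAdj G (E u) (E v)) × (LAdj G (E u) (E v) → adj H u v ≡ true)
  adjacent⇔LAdj u v = adjacent⇒LAdj , LAdj⇒adjacent
    where
      adjacent⇒LAdj : adj H u v ≡ true → LAdj G (E u) (E v)
      adjacent⇒LAdj uv = LAdj-wedge (adj⇒≢ uv ∘ E-injective) jᵤ jᵥ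
        (¬-not λ qr → triangle-free (Joins⇒adj jᵤ) qr (adjᴳ-sym (Joins⇒adj jᵥ)))
        where
          jᵤ = E-joins u (side u v)
          jᵥ : Joins (E v) (rep (u , side u v)) (rep (v , not (side v u)))
          jᵥ = subst (λ x → Joins (E v) x (rep (v , not (side v u)))) (rep-cong (inj₂ (adj-sym uv , refl , refl))) (E-joins v (side v u))
      LAdj⇒adjacent : LAdj G (E u) (E v) → adj H u v ≡ true
      LAdj⇒adjacent ladj with LAdj⇒SharedEndpoint square-free ladj
      ... | _ , _ , _ , jᵤ , jᵥ with E-endpoint jᵤ | E-endpoint jᵥ | u ≟ v
      ...   | _ , p | _ , q | yes refl = ⊥-elim (proj₁ ladj refl)
      ...   | _ , p | _ , q | no u≢v   = proj₁ (rep-meet (≡.trans p (≡.sym q)) u≢v)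

  isBicliqueLineGraph : IsBicliqueLineGraph H
  isBicliqueLineGraph =
    G , mk⤖ (E-injective , λ e → proj₁ (E-surjective e) , λ i≡ → ≡.trans (cong E i≡) (proj₂ (E-surjective e))) ,
    adjacent⇔LAdj

¬IsBicliqueLineGraph-claw : ¬ IsBicliqueLineGraph claw
¬IsBicliqueLineGraph-claw = ClawRoot.contradiction

¬IsBicliqueLineGraph-diamond : ¬ IsBicliqueLineGraph diamond
¬IsBicliqueLineGraph-diamond = DiamondRoot.contradiction

¬IsBicliqueLineGraph-C4 : ¬ IsBicliqueLineGraph C4
¬IsBicliqueLineGraph-C4 = C4Root.contradiction

hereditary⇒induced-IsBicliqueLineGraph : ∀ {H F} → IsHereditaryBicliqueLineGraph H → ContainsInduced H F →
                                         IsBicliqueLineGraph F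
hereditary⇒induced-IsBicliqueLineGraph {H} {F} hereditary (f , f-injective , f-adj)
  with hereditary (n F) f f-injective
... | G , φ , φ-adj = G , φ , λ u v → (λ uv → proj₁ (φ-adj u v) (≡.trans (f-adj u v) uv))
                                    , (λ l → ≡.trans (≡.sym (f-adj u v)) (proj₂ (φ-adj u v) l))

ContainsInduced-induced : ∀ {H F m} {f : Fin m → Fin (n H)} → Injective _≡_ _≡_ f →
                          ContainsInduced (induced H m f) F → ContainsInduced H F
ContainsInduced-induced {f = f} f-injective (g , g-injective , g-adj) =
  f ∘ g , g-injective ∘ f-injective , g-adj

theorem18 : (H : Graph) →
    IsHereditaryBicliqueLineGraph H ⇔
      (¬ ContainsInduced H claw × ¬ ContainsInduced H diamond × ¬ ContainsInduced H C4)
theorem18 H = mk⇔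
  (λ hereditary → ¬IsBicliqueLineGraph-claw    ∘ hereditary⇒induced-IsBicliqueLineGraph {H} {claw} hereditary
                , ¬IsBicliqueLineGraph-diamond ∘ hereditary⇒induced-IsBicliqueLineGraph {H} {diamond} hereditary
                , ¬IsBicliqueLineGraph-C4      ∘ hereditary⇒induced-IsBicliqueLineGraph {H} {C4} hereditary)
  (λ { (claw-free , diamond-free , C4-free) m f f-injective →
       LineGraphRoot.isBicliqueLineGraph (induced H m f)
         (claw-free    ∘ ContainsInduced-induced {H} {claw} f-injective)
         (diamond-free ∘ ContainsInduced-induced {H} {diamond} f-injective)
         (C4-free      ∘ ContainsInduced-induced {H} {C4} f-injective) })
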